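{- Let $n$ be a positive integer divisible by $4$. Treat $M(\gamma)$, $\gamma\in\{0,1\}^n$, as formal variables, and for $\gamma\in\{0,1\}^n$ let $|\gamma|=\gamma_1+\dots+\gamma_n$ (integer sum). For $j\in\{1,\dots,n\}$ let $\pi_j$ be the vector with $1$ in coordinate $j$ and $0$ elsewhere (addition coordinatewise mod 2). Let $V$ be the real vector space of formal linear combinations $\sum_{w\in\{0,2,\dots,n\}} d_w\sum_{|\gamma|=w}M(\gamma)$ (dimension $\frac n2+1$). For each $w\in\{0,2,4,\dots,n\}$ let \[T_w=\sum_{|\gamma|=w}\ \sum_{\{j,k\}\subseteq\{1,\dots,n\},\ j\neq k} M(\gamma+\pi_j+\pi_k),\] the inner sum being over unordered pairs of distinct indices; each $T_w$ lies in $V$. Then the dimension of the span of $T_0,T_2,\dots,T_n$ is $\frac n2+1$ if $n$ is not of the form $4u^2$ with $u$ an integer, and is $\frac n2$ if $n=4u^2$ for some integer $u$.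
   Formalization: The vector space V and the linear combinations defining the span of T_0, …, T_n are taken over the rationals instead of the reals. -}

module Defs where

open import Data.Bool using (Bool; true; false; not; if_then_else_)
open import Data.Nat using (ℕ; zero; suc; _<?_; _≟_)
import Data.Nat as ℕ
open import Data.Fin using (Fin; zero; suc; toℕ)
open import Data.Vec using (Vec; []; _∷_; updateAt; countᵇ)
open import Data.Vec.Properties using (≡-dec)
open import Data.List using (List; []; _∷_; _++_; map; concatMap; filterᵇ; allFin; sum; length)
open import Data.Integer using (+_)
open import Data.Rational using (ℚ; 0ℚ; _+_; _*_; _/_)
open import Data.Product using (Σ; _×_; _,_)
open import Relation.Binary.PropositionalEquality using (_≡_)
open import Relation.Nullary.Decidable using (⌊_⌋)
import Data.Bool as B

-- all of {0,1}^n, as Boolean vectors (true = 1)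
allVecs : (n : ℕ) → List (Vec Bool n)
allVecs zero    = [] ∷ []
allVecs (suc n) = map (false ∷_) (allVecs n) ++ map (true ∷_) (allVecs n)

weight : ∀ {n} → Vec Bool n → ℕ
weight γ = countᵇ (λ b → b) γ

-- γ + π_j (coordinatewise mod 2): flip coordinate j
addπ : ∀ {n} → Vec Bool n → Fin n → Vec Bool n
addπ γ j = updateAt γ j not

-- unordered pairs {j,k} of distinct indices, listed as (j,k) with j < k
pairs : (n : ℕ) → List (Fin n × Fin n)
pairs n = concatMap (λ j → map (λ k → (j , k)) (filterᵇ (λ k → ⌊ toℕ j <? toℕ k ⌋) (allFin n))) (allFin n)

occ : ∀ {n} → Vec Bool n → List (Vec Bool n) → ℕ
occ δ xs = length (filterᵇ (λ x → ⌊ ≡-dec B._≟_ x δ ⌋) xs)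

Tcoeff : (n w : ℕ) → Vec Bool n → ℕ
Tcoeff n w δ =
  occ δ (concatMap (λ γ → map (λ p → addπ (addπ γ (Data.Product.proj₁ p)) (Data.Product.proj₂ p)) (pairs n))
                   (filterᵇ (λ γ → ⌊ weight γ ≟ w ⌋) (allVecs n)))

-- T_w as a formal linear combination of the variables M(γ), i.e. the
-- function γ ↦ (coefficient of M(γ)), with rational coefficients
T : (n w : ℕ) → Vec Bool n → ℚ
T n w δ = (+ Tcoeff n w δ) / 1

sumℚ : (r : ℕ) → (Fin r → ℚ) → ℚ
sumℚ zero    f = 0ℚ
sumℚ (suc r) f = f zero + sumℚ r (λ i → f (suc i))

linComb : ∀ {X : Set} {r : ℕ} → (Fin r → ℚ) → (Fin r → X → ℚ) → X → ℚ
linComb {r = r} c v x = sumℚ r (λ i → c i * v i x)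

LinIndep : ∀ {X : Set} {r : ℕ} → (Fin r → X → ℚ) → Set
LinIndep {X} {r} v = (c : Fin r → ℚ) → ((x : X) → linComb c v x ≡ 0ℚ) → (i : Fin r) → c i ≡ 0ℚ

InSpan : ∀ {X : Set} {r : ℕ} → (Fin r → X → ℚ) → (X → ℚ) → Set
InSpan {X} {r} v y = Σ (Fin r → ℚ) λ c → (x : X) → linComb c v x ≡ y x

-- dim span{ v_0 , ... , v_{m-1} } = d : some d members of the family form a
-- basis of the span (linearly independent, and every v_j is in their span)
DimSpan : ∀ {X : Set} {m : ℕ} → (Fin m → X → ℚ) → ℕ → Set
DimSpan {X} {m} v d = Σ (Fin d → Fin m) λ s → LinIndep (λ i → v (s i)) × ((j : Fin m) → InSpan (λ i → v (s i)) (v j))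

-- the family T_0, T_2, ..., T_{2h} (index i ↦ T_{2i})
Tfamily : (n h : ℕ) → Fin (suc h) → Vec Bool n → ℚ
Tfamily n h i = T n (2 ℕ.* toℕ i)

module Submission where

-- The coefficient of M(δ) in T_w depends only on s = |δ|:
--    it is C(s,2), s(n−s) or C(n−s,2) according as w = s−2, s or s+2.  Hence a combination
--    Σ c_i T_{2i} takes at weight s the value Tsum_n f(s), f being c spread over the evens.
-- 2. Spectral theory (module Kac).  On polynomials of degree ≤ n the Kac operator
--    D_n = n x + (1 − x²) d/dx satisfies Π_{k≤n} (D_n − (n − 2k)) = 0 (proved through the
--    intertwinings D_{n+1}(1+x) = (1+x)(D_n + 1), D_{n+1}(x−1) = (x−1)(D_n − 1)), and
--    (1+x)ᵐ(x−1)ᵇ is an eigenvector of D_{m+b} for m − b.  Consequently D_n² F = n F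
--    forces F = 0 unless some (n − 2k)² equals n.
-- 3. Binomial conjugation (module Bridge).  For F = C(n,·)·f one has
--    D_n² F = C(n,·)·(n f + 2 Tsum_n f), so dependencies among the T's are exactly the
--    solutions of D_n² F = n F.
-- 4. Dimension count (module Rank).  If n ≠ 4u² no (n − 2k)² = 4(h − k)² equals n, so
--    the family is independent.  If n = 4u², the eigenvector for the eigenvalue 2u yields a
--    dependency with nonzero coefficient at T_0, while T_2, ..., T_n stay independent because
--    the system for their coefficients is triangular.
--
-- The hypothesis 4 ∣ n is used only to write n = h + h with h = n / 2, and 0 < n only to
-- rule out u = 0.  Local lemmas named ring are identities of commutative rings, discharged
-- by the ring solver.

module Counting where

  open import Defs
  open import Data.Bool using (Bool; true; false; if_then_else_; _∧_)
  import Data.Bool as B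
  import Data.Bool.Properties as BP
  open import Data.Nat using (ℕ; zero; suc; _+_; _*_; _∸_; _≡ᵇ_; _<ᵇ_; _≤_; z≤n; s≤s; _<?_; _≟_)
  open import Data.Nat.Properties using (+-suc; +-∸-assoc; m≤n⇒m≤1+n)
  open import Data.Fin using (Fin; zero; suc; toℕ)
  open import Data.Vec using (Vec; []; _∷_)
  open import Data.Vec.Properties using (≡-dec; ∷-injectiveˡ; ∷-injectiveʳ; updateAt-updateAt; updateAt-id-local)
  open import Data.List using (List; []; _∷_; _++_; map; concatMap; filterᵇ; allFin; length)
  open import Data.Nat.ListAction using (sum)
  open import Data.List.Properties using (map-tabulate; length-++; filter-++; map-∘)
  open import Data.Product using (_×_; _,_; proj₁; proj₂)
  open import Relation.Binary.PropositionalEquality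
  open import Relation.Nullary.Decidable using (⌊_⌋; isYes≗does; does-⇔; T?)
  open import Relation.Nullary using (¬_; yes; no)
  open import Data.Empty using (⊥-elim)
  open import Function using (_∘_; id; mk⇔)
  open import Data.Nat.Tactic.RingSolver using (solve-∀)

  private variable A B : Set

  ⟦_⟧ : Bool → ℕ
  ⟦ true ⟧ = 1
  ⟦ false ⟧ = 0

  ≟-ᵇ : ∀ m n → ⌊ m ≟ n ⌋ ≡ (m ≡ᵇ n)
  ≟-ᵇ m n = isYes≗does (m ≟ n)

  <?-ᵇ : ∀ m n → ⌊ m <? n ⌋ ≡ (m <ᵇ n)
  <?-ᵇ m n = isYes≗does (m <? n)

  count : (A → Bool) → List A → ℕ
  count P xs = length (filterᵇ P xs)

  sumOver : (A → ℕ) → List A → ℕ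
  sumOver f xs = sum (map f xs)

  count-∷ : ∀ (P : A → Bool) x xs → count P (x ∷ xs) ≡ ⟦ P x ⟧ + count P xs
  count-∷ P x xs with P x
  ... | true = refl
  ... | false = refl

  count-++ : ∀ (P : A → Bool) xs ys → count P (xs ++ ys) ≡ count P xs + count P ys
  count-++ P xs ys = trans (cong length (filter-++ (T? ∘ P) xs ys)) (length-++ (filterᵇ P xs))

  count≡sumOver : ∀ (P : A → Bool) xs → count P xs ≡ sumOver (λ x → ⟦ P x ⟧) xs
  count≡sumOver P [] = refl
  count≡sumOver P (x ∷ xs) = trans (count-∷ P x xs) (cong (⟦ P x ⟧ +_) (count≡sumOver P xs))

  sumOver-cong : ∀ (f g : A → ℕ) xs → (∀ x → f x ≡ g x) → sumOver f xs ≡ sumOver g xs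
  sumOver-cong f g [] e = refl
  sumOver-cong f g (x ∷ xs) e = cong₂ _+_ (e x) (sumOver-cong f g xs e)

  count-cong : ∀ (P Q : A → Bool) xs → (∀ x → P x ≡ Q x) → count P xs ≡ count Q xs
  count-cong P Q xs e =
    trans (count≡sumOver P xs) (trans (sumOver-cong (λ x → ⟦ P x ⟧) (λ x → ⟦ Q x ⟧) xs (cong ⟦_⟧ ∘ e)) (sym (count≡sumOver Q xs)))

  sumOver-zero : ∀ (f : A → ℕ) xs → (∀ x → f x ≡ 0) → sumOver f xs ≡ 0
  sumOver-zero f [] e = refl
  sumOver-zero f (x ∷ xs) e = cong₂ _+_ (e x) (sumOver-zero f xs e)

  count-none : ∀ (P : A → Bool) xs → (∀ x → P x ≡ false) → count P xs ≡ 0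
  count-none P xs e = trans (count≡sumOver P xs) (sumOver-zero _ xs (cong ⟦_⟧ ∘ e))

  count-map : ∀ (P : B → Bool) (f : A → B) xs → count P (map f xs) ≡ count (P ∘ f) xs
  count-map P f xs = trans (count≡sumOver P (map f xs))
    (trans (cong sum (sym (map-∘ xs))) (sym (count≡sumOver (P ∘ f) xs)))

  sumOver-+ : ∀ (f g : A → ℕ) xs → sumOver (λ x → f x + g x) xs ≡ sumOver f xs + sumOver g xs
  sumOver-+ f g [] = refl
  sumOver-+ f g (x ∷ xs) rewrite sumOver-+ f g xs = interchange (f x) (g x) (sumOver f xs) (sumOver g xs)
    where
    interchange : ∀ a b c d → a + b + (c + d) ≡ a + c + (b + d)
    interchange = solve-∀

  filterᵇ-∷ : ∀ (q : A → Bool) x xs → filterᵇ q (x ∷ xs) ≡ (if q x then x ∷ filterᵇ q xs else filterᵇ q xs)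
  filterᵇ-∷ q x xs with q x
  ... | true = refl
  ... | false = refl

  count-filter : ∀ (P q : A → Bool) xs → count P (filterᵇ q xs) ≡ count (λ x → q x ∧ P x) xs
  count-filter P q [] = refl
  count-filter P q (x ∷ xs) =
    trans (cong (count P) (filterᵇ-∷ q x xs)) (trans (byCase (q x)) (sym (count-∷ (λ x → q x ∧ P x) x xs)))
    where
    byCase : ∀ b → count P (if b then x ∷ filterᵇ q xs else filterᵇ q xs) ≡ ⟦ b ∧ P x ⟧ + count (λ x → q x ∧ P x) xs
    byCase true = trans (count-∷ P x (filterᵇ q xs)) (cong (⟦ P x ⟧ +_) (count-filter P q xs))
    byCase false = count-filter P q xs

  sumOver-filter : ∀ (W : A → Bool) (Q : A → B → Bool) L M →
    sumOver (λ x → count (Q x) M) (filterᵇ W L) ≡ sumOver (λ x → count (λ p → W x ∧ Q x p) M) L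
  sumOver-filter W Q [] M = refl
  sumOver-filter W Q (x ∷ L) M = trans (cong (sumOver (λ x → count (Q x) M)) (filterᵇ-∷ W x L)) (byCase (W x) refl)
    where
    byCase : ∀ b → W x ≡ b → sumOver (λ x → count (Q x) M) (if b then x ∷ filterᵇ W L else filterᵇ W L)
                              ≡ sumOver (λ x → count (λ p → W x ∧ Q x p) M) (x ∷ L)
    byCase true e = cong₂ _+_ (count-cong _ _ M (λ p → cong (_∧ Q x p) (sym e))) (sumOver-filter W Q L M)
    byCase false e = cong₂ _+_ (sym (count-none _ M (λ p → cong (_∧ Q x p) e))) (sumOver-filter W Q L M)

  count-concatMap : ∀ (P : B → Bool) (H : A → List B) xs → count P (concatMap H xs) ≡ sumOver (λ x → count P (H x)) xs
  count-concatMap P H [] = refl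
  count-concatMap P H (x ∷ xs) = trans (count-++ P (H x) (concatMap H xs)) (cong (count P (H x) +_) (count-concatMap P H xs))

  double-counting : ∀ (R : A → B → Bool) L M → sumOver (λ x → count (R x) M) L ≡ sumOver (λ y → count (λ x → R x y) L) M
  double-counting R [] M = sym (sumOver-zero _ M (λ _ → refl))
  double-counting R (x ∷ L) M = trans (cong₂ _+_ (count≡sumOver (R x) M) (double-counting R L M))
    (trans (sym (sumOver-+ (λ y → ⟦ R x y ⟧) (λ y → count (λ x → R x y) L) M))
      (sumOver-cong _ _ M (λ y → sym (count-∷ (λ x → R x y) x L))))

  allFin-suc : ∀ n → allFin (suc n) ≡ zero ∷ map suc (allFin n)
  allFin-suc n = cong (zero ∷_) (sym (map-tabulate id suc))

  count-allFin-suc : ∀ n (P : Fin (suc n) → Bool) → count P (allFin (suc n)) ≡ ⟦ P zero ⟧ + count (P ∘ suc) (allFin n)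
  count-allFin-suc n P = trans (cong (count P) (allFin-suc n))
    (trans (count-∷ P zero (map suc (allFin n))) (cong (⟦ P zero ⟧ +_) (count-map P suc (allFin n))))

  sumOver-allFin-suc : ∀ n (F : Fin (suc n) → ℕ) → sumOver F (allFin (suc n)) ≡ F zero + sumOver (F ∘ suc) (allFin n)
  sumOver-allFin-suc n F = trans (cong (sumOver F) (allFin-suc n)) (cong (λ xs → F zero + sum xs) (sym (map-∘ (allFin n))))

  _==_ : ∀ {n} → Vec Bool n → Vec Bool n → Bool
  x == y = ⌊ ≡-dec B._≟_ x y ⌋

  ==-complete : ∀ {n} {x y : Vec Bool n} → x ≡ y → (x == y) ≡ true
  ==-complete {x = x} refl with ≡-dec B._≟_ x x
  ... | yes _ = refl
  ... | no x≢x = ⊥-elim (x≢x refl)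

  ==-sound : ∀ {n} (x y : Vec Bool n) → (x == y) ≡ true → x ≡ y
  ==-sound x y e with ≡-dec B._≟_ x y
  ... | yes x≡y = x≡y

  ==-reject : ∀ {n} (x y : Vec Bool n) → ¬ (x ≡ y) → (x == y) ≡ false
  ==-reject x y x≢y with ≡-dec B._≟_ x y
  ... | yes x≡y = ⊥-elim (x≢y x≡y)
  ... | no _ = refl

  ==-⇔ : ∀ {n m} (x y : Vec Bool n) (x' y' : Vec Bool m) → (x ≡ y → x' ≡ y') → (x' ≡ y' → x ≡ y) → (x == y) ≡ (x' == y')
  ==-⇔ x y x' y' to from =
    trans (isYes≗does (≡-dec B._≟_ x y)) (trans (does-⇔ (mk⇔ to from) (≡-dec B._≟_ x y) (≡-dec B._≟_ x' y')) (sym (isYes≗does (≡-dec B._≟_ x' y'))))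

  allVecs-once : ∀ n (y : Vec Bool n) → count (_== y) (allVecs n) ≡ 1
  allVecs-once zero [] = cong (λ b → ⟦ b ⟧ + 0) (==-complete {x = []} refl)
  allVecs-once (suc n) (b ∷ y) =
    trans (count-++ _ (map (false ∷_) (allVecs n)) (map (true ∷_) (allVecs n)))
    (trans (cong₂ _+_ (count-map _ (false ∷_) (allVecs n)) (count-map _ (true ∷_) (allVecs n))) (byHead b))
    where
    sameHead : ∀ a → count (λ x → (a ∷ x) == (a ∷ y)) (allVecs n) ≡ 1
    sameHead a = trans (count-cong _ _ (allVecs n) (λ x → ==-⇔ (a ∷ x) (a ∷ y) x y ∷-injectiveʳ (cong (a ∷_))))
                       (allVecs-once n y)
    otherHead : ∀ a a' → ¬ (a ≡ a') → count (λ x → (a ∷ x) == (a' ∷ y)) (allVecs n) ≡ 0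
    otherHead a a' a≢a' = count-none _ (allVecs n) (λ x → ==-reject _ _ (a≢a' ∘ ∷-injectiveˡ))
    byHead : ∀ b → count (λ x → (false ∷ x) == (b ∷ y)) (allVecs n) + count (λ x → (true ∷ x) == (b ∷ y)) (allVecs n) ≡ 1
    byHead false = cong₂ _+_ (sameHead false) (otherHead true false (λ ()))
    byHead true = cong₂ _+_ (otherHead false true (λ ())) (sameHead true)

  count-allVecs-point : ∀ {n} (W : Vec Bool n → Bool) (y : Vec Bool n) → count (λ γ → W γ ∧ (γ == y)) (allVecs n) ≡ ⟦ W y ⟧
  count-allVecs-point {n} W y = trans (count-cong _ _ (allVecs n) onlyAtY) (byValue (W y))
    where
    onlyAtY : ∀ γ → (W γ ∧ (γ == y)) ≡ (W y ∧ (γ == y))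
    onlyAtY γ with γ == y in e
    ... | true = cong (_∧ true) (cong W (==-sound γ y e))
    ... | false = trans (BP.∧-zeroʳ (W γ)) (sym (BP.∧-zeroʳ (W y)))
    byValue : ∀ b → count (λ γ → b ∧ (γ == y)) (allVecs n) ≡ ⟦ b ⟧
    byValue true = allVecs-once n y
    byValue false = count-none _ (allVecs n) (λ _ → refl)

  weight≤ : ∀ {n} (x : Vec Bool n) → weight x ≤ n
  weight≤ [] = z≤n
  weight≤ (true ∷ x) = s≤s (weight≤ x)
  weight≤ (false ∷ x) = m≤n⇒m≤1+n (weight≤ x)

  addπ-involutive : ∀ {n} (x : Vec Bool n) i → addπ (addπ x i) i ≡ x
  addπ-involutive x i = trans (updateAt-updateAt i x) (updateAt-id-local i x (BP.not-involutive _))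

  flip₂ : ∀ {n} → Vec Bool n → Fin n × Fin n → Vec Bool n
  flip₂ γ (j , k) = addπ (addπ γ j) k

  unflip₂ : ∀ {n} → Vec Bool n → Fin n × Fin n → Vec Bool n
  unflip₂ δ (j , k) = addπ (addπ δ k) j

  unflip₂-flip₂ : ∀ {n} (γ : Vec Bool n) p → unflip₂ (flip₂ γ p) p ≡ γ
  unflip₂-flip₂ γ (j , k) = trans (cong (λ z → addπ z j) (addπ-involutive (addπ γ j) k)) (addπ-involutive γ j)

  flip₂-unflip₂ : ∀ {n} (δ : Vec Bool n) p → flip₂ (unflip₂ δ p) p ≡ δ
  flip₂-unflip₂ δ (j , k) = trans (cong (λ z → addπ z k) (addπ-involutive (addπ δ k) j)) (addπ-involutive δ k)

  flip₂-== : ∀ {n} (γ δ : Vec Bool n) p → (flip₂ γ p == δ) ≡ (γ == unflip₂ δ p)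
  flip₂-== γ δ p = ==-⇔ _ _ _ _ (λ e → trans (sym (unflip₂-flip₂ γ p)) (cong (λ z → unflip₂ z p) e))
                                (λ e → trans (cong (λ z → flip₂ z p) e) (flip₂-unflip₂ δ p))

  -- double counting: T_w(δ) is the number of pairs {j,k} with |δ + π_j + π_k| = w
  Tcoeff≡pairCount : ∀ n w (δ : Vec Bool n) → Tcoeff n w δ ≡ count (λ p → weight (unflip₂ δ p) ≡ᵇ w) (pairs n)
  Tcoeff≡pairCount n w δ =
    begin
      Tcoeff n w δ
    ≡⟨ count-concatMap _ (λ γ → map (flip₂ γ) (pairs n)) (filterᵇ hasWeight (allVecs n)) ⟩
      sumOver (λ γ → count (_== δ) (map (flip₂ γ) (pairs n))) (filterᵇ hasWeight (allVecs n))
    ≡⟨ sumOver-cong _ _ (filterᵇ hasWeight (allVecs n)) (λ γ → count-map (_== δ) (flip₂ γ) (pairs n)) ⟩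
      sumOver (λ γ → count (λ p → flip₂ γ p == δ) (pairs n)) (filterᵇ hasWeight (allVecs n))
    ≡⟨ sumOver-filter hasWeight (λ γ p → flip₂ γ p == δ) (allVecs n) (pairs n) ⟩
      sumOver (λ γ → count (λ p → hasWeight γ ∧ (flip₂ γ p == δ)) (pairs n)) (allVecs n)
    ≡⟨ double-counting (λ γ p → hasWeight γ ∧ (flip₂ γ p == δ)) (allVecs n) (pairs n) ⟩
      sumOver (λ p → count (λ γ → hasWeight γ ∧ (flip₂ γ p == δ)) (allVecs n)) (pairs n)
    ≡⟨ sumOver-cong _ _ (pairs n) (λ p →
         trans (count-cong _ _ (allVecs n) (λ γ → cong (hasWeight γ ∧_) (flip₂-== γ δ p)))
               (count-allVecs-point hasWeight (unflip₂ δ p))) ⟩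
      sumOver (λ p → ⟦ hasWeight (unflip₂ δ p) ⟧) (pairs n)
    ≡⟨ sym (count≡sumOver _ (pairs n)) ⟩
      count (λ p → hasWeight (unflip₂ δ p)) (pairs n)
    ≡⟨ count-cong _ _ (pairs n) (λ p → ≟-ᵇ (weight (unflip₂ δ p)) w) ⟩
      count (λ p → weight (unflip₂ δ p) ≡ᵇ w) (pairs n)
    ∎
    where
    open ≡-Reasoning
    hasWeight : Vec Bool n → Bool
    hasWeight γ = ⌊ weight γ ≟ w ⌋

  countRows : ∀ n → (Fin n × Fin n → Bool) → ℕ
  countRows n P = sumOver (λ j → count (λ k → (toℕ j <ᵇ toℕ k) ∧ P (j , k)) (allFin n)) (allFin n)

  count-pairs : ∀ n (P : Fin n × Fin n → Bool) → count P (pairs n) ≡ countRows n P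
  count-pairs n P = trans (count-concatMap P (λ j → map (j ,_) (row j)) (allFin n)) (sumOver-cong _ _ (allFin n) (λ j →
     trans (count-map P (j ,_) (row j)) (trans (count-filter (λ k → P (j , k)) (λ k → ⌊ toℕ j <? toℕ k ⌋) (allFin n))
       (count-cong _ _ (allFin n) (λ k → cong (_∧ P (j , k)) (<?-ᵇ (toℕ j) (toℕ k)))))))
    where
    row : Fin n → List (Fin n)
    row j = filterᵇ (λ k → ⌊ toℕ j <? toℕ k ⌋) (allFin n)

  count-pairs-suc : ∀ n (P : Fin (suc n) × Fin (suc n) → Bool) →
    count P (pairs (suc n)) ≡ count (λ k → P (zero , suc k)) (allFin n) + count (λ p → P (suc (proj₁ p) , suc (proj₂ p))) (pairs n)
  count-pairs-suc n P =
    trans (count-pairs (suc n) P)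
    (trans (sumOver-allFin-suc n (λ j → count (λ k → (toℕ j <ᵇ toℕ k) ∧ P (j , k)) (allFin (suc n))))
    (cong₂ _+_ (count-allFin-suc n (λ k → (0 <ᵇ toℕ k) ∧ P (zero , k)))
      (trans (sumOver-cong _ _ (allFin n) (λ j → count-allFin-suc n (λ k → (toℕ (suc j) <ᵇ toℕ k) ∧ P (suc j , k))))
        (sym (count-pairs n _)))))

  choose2 : ℕ → ℕ
  choose2 zero = 0
  choose2 (suc s) = s + choose2 s

  -- the number of k with c + |δ + π_k| = w, as a function of s = |δ|
  -- (the offset c makes the statement stable under the induction on n)
  oneFlipCount : ℕ → ℕ → ℕ → ℕ → ℕ
  oneFlipCount n c w s = ⟦ c + s ≡ᵇ suc w ⟧ * s + ⟦ suc (c + s) ≡ᵇ w ⟧ * (n ∸ s)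

  twoFlipCount : ℕ → ℕ → ℕ → ℕ → ℕ
  twoFlipCount n c w s =
    ⟦ c + s ≡ᵇ suc (suc w) ⟧ * choose2 s + ⟦ c + s ≡ᵇ w ⟧ * (s * (n ∸ s)) + ⟦ suc (suc (c + s)) ≡ᵇ w ⟧ * choose2 (n ∸ s)

  -- a leading letter 1 contributes one unit of weight, which moves into the offset
  shift-offset : ∀ c x w → (c + suc x ≡ᵇ w) ≡ (suc c + x ≡ᵇ w)
  shift-offset c x w = cong (_≡ᵇ w) (+-suc c x)

  oneFlipCount-correct : ∀ n c w (δ : Vec Bool n) →
    count (λ k → c + weight (addπ δ k) ≡ᵇ w) (allFin n) ≡ oneFlipCount n c w (weight δ)
  oneFlipCount-correct zero c w [] = sym (ring ⟦ c + 0 ≡ᵇ suc w ⟧ ⟦ suc (c + 0) ≡ᵇ w ⟧)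
    where
    ring : ∀ a b → a * 0 + b * 0 ≡ 0
    ring = solve-∀
  oneFlipCount-correct (suc n) c w (true ∷ δ) =
    trans (count-allFin-suc n (λ k → c + weight (addπ (true ∷ δ) k) ≡ᵇ w))
    (trans (cong (⟦ c + weight δ ≡ᵇ w ⟧ +_)
              (trans (count-cong _ _ (allFin n) (λ k → shift-offset c (weight (addπ δ k)) w)) (oneFlipCount-correct n (suc c) w δ)))
    (trans (ring ⟦ c + weight δ ≡ᵇ w ⟧ (weight δ) (⟦ suc (suc (c + weight δ)) ≡ᵇ w ⟧ * (n ∸ weight δ)))
      (cong₂ (λ a b → ⟦ a ⟧ * suc (weight δ) + ⟦ b ⟧ * (n ∸ weight δ))
             (sym (shift-offset c (weight δ) (suc w))) (sym (cong (λ x → suc x ≡ᵇ w) (+-suc c (weight δ)))))))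
    where
    ring : ∀ a s X → a + (a * s + X) ≡ a * suc s + X
    ring = solve-∀
  oneFlipCount-correct (suc n) c w (false ∷ δ) =
    trans (count-allFin-suc n (λ k → c + weight (addπ (false ∷ δ) k) ≡ᵇ w))
    (trans (cong (⟦ c + suc (weight δ) ≡ᵇ w ⟧ +_) (oneFlipCount-correct n c w δ))
    (trans (cong (λ b → ⟦ b ⟧ + oneFlipCount n c w (weight δ)) (shift-offset c (weight δ) w))
    (trans (ring ⟦ c + weight δ ≡ᵇ suc w ⟧ (weight δ) ⟦ suc (c + weight δ) ≡ᵇ w ⟧ (n ∸ weight δ))
    (cong (λ m → ⟦ c + weight δ ≡ᵇ suc w ⟧ * weight δ + ⟦ suc (c + weight δ) ≡ᵇ w ⟧ * m) (sym (+-∸-assoc 1 (weight≤ δ)))))))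
    where
    ring : ∀ X s Y m → Y + (X * s + Y * m) ≡ X * s + Y * suc m
    ring = solve-∀

  twoFlipCount-correct : ∀ n c w (δ : Vec Bool n) →
    count (λ p → c + weight (unflip₂ δ p) ≡ᵇ w) (pairs n) ≡ twoFlipCount n c w (weight δ)
  twoFlipCount-correct zero c w [] = sym (ring ⟦ c + 0 ≡ᵇ suc (suc w) ⟧ ⟦ c + 0 ≡ᵇ w ⟧ ⟦ suc (suc (c + 0)) ≡ᵇ w ⟧)
    where
    ring : ∀ a b d → a * 0 + b * 0 + d * 0 ≡ 0
    ring = solve-∀
  twoFlipCount-correct (suc n) c w (true ∷ δ) =
    trans (count-pairs-suc n (λ p → c + weight (unflip₂ (true ∷ δ) p) ≡ᵇ w))
    (trans (cong₂ _+_ (oneFlipCount-correct n c w δ)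
       (trans (count-cong _ _ (pairs n) (λ p → shift-offset c (weight (unflip₂ δ p)) w)) (twoFlipCount-correct n (suc c) w δ)))
    (trans (ring ⟦ c + s ≡ᵇ suc w ⟧ ⟦ suc (c + s) ≡ᵇ w ⟧ ⟦ suc (suc (suc (c + s))) ≡ᵇ w ⟧ s (n ∸ s) (choose2 s) (choose2 (n ∸ s)))
      (sym (unfold c s))))
    where
    s = weight δ
    ring : ∀ X Y Z s m C D → X * s + Y * m + (X * C + Y * (s * m) + Z * D) ≡ X * (s + C) + Y * (suc s * m) + Z * D
    ring = solve-∀
    unfold : ∀ c s → twoFlipCount (suc n) c w (suc s)
           ≡ ⟦ c + s ≡ᵇ suc w ⟧ * (s + choose2 s) + ⟦ suc (c + s) ≡ᵇ w ⟧ * (suc s * (n ∸ s)) + ⟦ suc (suc (suc (c + s))) ≡ᵇ w ⟧ * choose2 (n ∸ s)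
    unfold c s rewrite +-suc c s = refl
  twoFlipCount-correct (suc n) c w (false ∷ δ) =
    trans (count-pairs-suc n (λ p → c + weight (unflip₂ (false ∷ δ) p) ≡ᵇ w))
    (trans (cong₂ _+_ (trans (count-cong _ _ (allFin n) (λ k → shift-offset c (weight (addπ δ k)) w)) (oneFlipCount-correct n (suc c) w δ))
                      (twoFlipCount-correct n c w δ))
    (trans (ring ⟦ c + s ≡ᵇ suc (suc w) ⟧ ⟦ c + s ≡ᵇ w ⟧ ⟦ suc (suc (c + s)) ≡ᵇ w ⟧ s (n ∸ s) (choose2 s) (choose2 (n ∸ s)))
      (cong (λ m → ⟦ c + s ≡ᵇ suc (suc w) ⟧ * choose2 s + ⟦ c + s ≡ᵇ w ⟧ * (s * m) + ⟦ suc (suc (c + s)) ≡ᵇ w ⟧ * choose2 m)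
         (sym (+-∸-assoc 1 (weight≤ δ))))))
    where
    s = weight δ
    ring : ∀ X Y Z s m C D → Y * s + Z * m + (X * C + Y * (s * m) + Z * D) ≡ X * C + Y * (s * suc m) + Z * (m + D)
    ring = solve-∀

  Tcoeff-formula : ∀ n w (δ : Vec Bool n) → Tcoeff n w δ ≡ twoFlipCount n 0 w (weight δ)
  Tcoeff-formula n w δ = trans (Tcoeff≡pairCount n w δ) (twoFlipCount-correct n 0 w δ)

-- Spectral theory of the Kac operator on finitely supported rational sequences.
-- A sequence F is read as the polynomial f(x) = Σ F(v) xᵛ; then
--   P f = (1+x) f,   Q f = (x−1) f,   X f = x f,   D_n f = n x f + (1−x²) f′,
-- and D_{n+1} P = P (D_n + 1), D_{n+1} Q = Q (D_n − 1).
module Kac where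

  open import Data.Nat as ℕ using (ℕ; zero; suc)
  import Data.Nat.Properties as NP
  open import Data.Rational using (ℚ; 0ℚ; 1ℚ; _+_; _*_; _-_; -_; 1/_; ½)
  open import Data.Rational.Properties using (+-*-commutativeRing; _≟_; *-inverseˡ; *-zeroʳ; *-assoc)
  open import Data.Rational.Base using (≢-nonZero)
  open import Tactic.RingSolver using (solve-∀)
  open import Tactic.RingSolver.Core.AlmostCommutativeRing using (AlmostCommutativeRing; fromCommutativeRing)
  open import Relation.Binary.PropositionalEquality
  open import Relation.Nullary using (¬_)
  open import Relation.Nullary.Decidable.Core using (dec⇒maybe)
  open import Data.Product using (_×_; _,_; proj₁; proj₂)
  open import Data.Sum using (inj₁; inj₂)

  ℚ-ring : AlmostCommutativeRing _ _
  ℚ-ring = fromCommutativeRing +-*-commutativeRing (λ x → dec⇒maybe (0ℚ ≟ x))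

  ι : ℕ → ℚ
  ι zero = 0ℚ
  ι (suc k) = 1ℚ + ι k

  ι-+ : ∀ a b → ι (a ℕ.+ b) ≡ ι a + ι b
  ι-+ zero b = sym (ring (ι b))
    where
    ring : ∀ x → 0ℚ + x ≡ x
    ring = solve-∀ ℚ-ring
  ι-+ (suc a) b = trans (cong (1ℚ +_) (ι-+ a b)) (ring (ι a) (ι b))
    where
    ring : ∀ x y → 1ℚ + (x + y) ≡ (1ℚ + x) + y
    ring = solve-∀ ℚ-ring

  ι-* : ∀ a b → ι (a ℕ.* b) ≡ ι a * ι b
  ι-* zero b = sym (ring (ι b))
    where
    ring : ∀ x → 0ℚ * x ≡ 0ℚ
    ring = solve-∀ ℚ-ring
  ι-* (suc a) b = trans (ι-+ b (a ℕ.* b)) (trans (cong (ι b +_) (ι-* a b)) (ring (ι a) (ι b)))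
    where
    ring : ∀ x y → y + x * y ≡ (1ℚ + x) * y
    ring = solve-∀ ℚ-ring

  cancel-nonzero : ∀ x y → x * y ≡ 0ℚ → ¬ (x ≡ 0ℚ) → y ≡ 0ℚ
  cancel-nonzero x y xy≡0 x≢0 =
    trans (sym (ring y)) (trans (cong (_* y) (sym (*-inverseˡ x)))
      (trans (*-assoc (1/ x) x y) (trans (cong ((1/ x) *_) xy≡0) (*-zeroʳ (1/ x)))))
    where
    instance _ = ≢-nonZero x≢0
    ring : ∀ y → 1ℚ * y ≡ y
    ring = solve-∀ ℚ-ring

  0≢1 : ¬ (0ℚ ≡ 1ℚ)
  0≢1 ()

  Seq : Set
  Seq = ℕ → ℚ

  infix 4 _≈_
  _≈_ : Seq → Seq → Set
  F ≈ G = ∀ v → F v ≡ G v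

  ≈-trans : ∀ {F G H} → F ≈ G → G ≈ H → F ≈ H
  ≈-trans e1 e2 v = trans (e1 v) (e2 v)

  ≈-sym : ∀ {F G} → F ≈ G → G ≈ F
  ≈-sym e v = sym (e v)

  0ₛ : Seq
  0ₛ _ = 0ℚ

  lc : ℚ → Seq → ℚ → Seq → Seq
  lc a F b G v = a * F v + b * G v

  lc-cong : ∀ a b {F F' G G'} → F ≈ F' → G ≈ G' → lc a F b G ≈ lc a F' b G'
  lc-cong a b e1 e2 v = cong₂ (λ x y → a * x + b * y) (e1 v) (e2 v)

  scale : ℚ → Seq → Seq
  scale a F v = a * F v

  -- F vanishes beyond index n, i.e. f has degree ≤ n
  SupportedIn : ℕ → Seq → Set
  SupportedIn n F = ∀ v → n ℕ.< v → F v ≡ 0ℚ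

  P : Seq → Seq
  P F zero = F zero
  P F (suc v) = F v + F (suc v)

  Q : Seq → Seq
  Q F zero = - F zero
  Q F (suc v) = F v - F (suc v)

  X : Seq → Seq
  X F zero = 0ℚ
  X F (suc v) = F v

  D : ℕ → Seq → Seq
  D n F zero = F 1
  D n F (suc v) = (ι n - ι v) * F v + ι (suc (suc v)) * F (suc (suc v))

  Linear : (Seq → Seq) → Set
  Linear Op = (∀ F G → F ≈ G → Op F ≈ Op G) × (∀ a F b G → Op (lc a F b G) ≈ lc a (Op F) b (Op G))

  P-linear : Linear P
  P-linear = (λ { F G e zero → e 0 ; F G e (suc v) → cong₂ _+_ (e v) (e (suc v)) }) ,
             (λ { a F b G zero → refl ; a F b G (suc v) → ring a b (F v) (G v) (F (suc v)) (G (suc v)) })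
    where
    ring : ∀ a b x y x' y' → (a * x + b * y) + (a * x' + b * y') ≡ a * (x + x') + b * (y + y')
    ring = solve-∀ ℚ-ring

  Q-linear : Linear Q
  Q-linear = (λ { F G e zero → cong -_ (e 0) ; F G e (suc v) → cong₂ _-_ (e v) (e (suc v)) }) ,
             (λ { a F b G zero → ring₀ a b (F 0) (G 0) ; a F b G (suc v) → ring a b (F v) (G v) (F (suc v)) (G (suc v)) })
    where
    ring₀ : ∀ a b x y → - (a * x + b * y) ≡ a * (- x) + b * (- y)
    ring₀ = solve-∀ ℚ-ring
    ring : ∀ a b x y x' y' → (a * x + b * y) - (a * x' + b * y') ≡ a * (x - x') + b * (y - y')
    ring = solve-∀ ℚ-ring

  D-linear : ∀ n → Linear (D n)
  D-linear n =
    (λ { F G e zero → e 1 ; F G e (suc v) → cong₂ (λ x y → (ι n - ι v) * x + ι (suc (suc v)) * y) (e v) (e (suc (suc v))) }) ,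
    (λ { a F b G zero → refl
       ; a F b G (suc v) → ring (ι n - ι v) (ι (suc (suc v))) a b (F v) (G v) (F (suc (suc v))) (G (suc (suc v))) })
    where
    ring : ∀ c d a b x y x' y' → c * (a * x + b * y) + d * (a * x' + b * y') ≡ a * (c * x + d * x') + b * (c * y + d * y')
    ring = solve-∀ ℚ-ring

  linear-zero : ∀ Op → Linear Op → Op 0ₛ ≈ 0ₛ
  linear-zero Op (respects , linearity) v =
    trans (respects 0ₛ (lc 0ℚ 0ₛ 0ℚ 0ₛ) (λ _ → refl) v) (trans (linearity 0ℚ 0ₛ 0ℚ 0ₛ v) (ring (Op 0ₛ v)))
    where
    ring : ∀ x → 0ℚ * x + 0ℚ * x ≡ 0ℚ
    ring = solve-∀ ℚ-ring

  linear-scale : ∀ Op → Linear Op → ∀ a F → Op (scale a F) ≈ scale a (Op F)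
  linear-scale Op (respects , linearity) a F v =
    trans (respects _ (lc a F 0ℚ F) (λ w → sym (ring a (F w))) v) (trans (linearity a F 0ℚ F v) (ring a (Op F v)))
    where
    ring : ∀ a x → a * x + 0ℚ * x ≡ a * x
    ring = solve-∀ ℚ-ring

  ∘-linear : ∀ Op Op' → Linear Op → Linear Op' → Linear (λ F → Op (Op' F))
  ∘-linear Op Op' (respects , linearity) (respects' , linearity') =
    (λ F G e → respects _ _ (respects' F G e)) ,
    (λ a F b G → ≈-trans (respects _ _ (linearity' a F b G)) (linearity a (Op' F) b (Op' G)))

  D-P : ∀ n F → D (suc n) (P F) ≈ lc 1ℚ (P F) 1ℚ (P (D n F))
  D-P n F zero = ring (F 0) (F 1)
    where
    ring : ∀ a b → a + b ≡ 1ℚ * a + 1ℚ * b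
    ring = solve-∀ ℚ-ring
  D-P n F (suc zero) = ring (ι n) (F 0) (F 1) (F 2)
    where
    ring : ∀ N a b c → ((1ℚ + N) - 0ℚ) * a + (1ℚ + (1ℚ + 0ℚ)) * (b + c)
                     ≡ 1ℚ * (a + b) + 1ℚ * (b + ((N - 0ℚ) * a + (1ℚ + (1ℚ + 0ℚ)) * c))
    ring = solve-∀ ℚ-ring
  D-P n F (suc (suc w)) = ring (ι n) (ι w) (F w) (F (suc w)) (F (suc (suc w))) (F (suc (suc (suc w))))
    where
    ring : ∀ N W a b c d → ((1ℚ + N) - (1ℚ + W)) * (a + b) + (1ℚ + (1ℚ + (1ℚ + W))) * (c + d)
        ≡ 1ℚ * (b + c) + 1ℚ * (((N - W) * a + (1ℚ + (1ℚ + W)) * c) + ((N - (1ℚ + W)) * b + (1ℚ + (1ℚ + (1ℚ + W))) * d))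
    ring = solve-∀ ℚ-ring

  D-Q : ∀ n F → D (suc n) (Q F) ≈ lc (- 1ℚ) (Q F) 1ℚ (Q (D n F))
  D-Q n F zero = ring (F 0) (F 1)
    where
    ring : ∀ a b → a - b ≡ (- 1ℚ) * (- a) + 1ℚ * (- b)
    ring = solve-∀ ℚ-ring
  D-Q n F (suc zero) = ring (ι n) (F 0) (F 1) (F 2)
    where
    ring : ∀ N a b c → ((1ℚ + N) - 0ℚ) * (- a) + (1ℚ + (1ℚ + 0ℚ)) * (b - c)
                     ≡ (- 1ℚ) * (a - b) + 1ℚ * (b - ((N - 0ℚ) * a + (1ℚ + (1ℚ + 0ℚ)) * c))
    ring = solve-∀ ℚ-ring
  D-Q n F (suc (suc w)) = ring (ι n) (ι w) (F w) (F (suc w)) (F (suc (suc w))) (F (suc (suc (suc w))))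
    where
    ring : ∀ N W a b c d → ((1ℚ + N) - (1ℚ + W)) * (a - b) + (1ℚ + (1ℚ + (1ℚ + W))) * (c - d)
        ≡ (- 1ℚ) * (b - c) + 1ℚ * (((N - W) * a + (1ℚ + (1ℚ + W)) * c) - ((N - (1ℚ + W)) * b + (1ℚ + (1ℚ + (1ℚ + W))) * d))
    ring = solve-∀ ℚ-ring

  Dsub : ℕ → ℚ → Seq → Seq
  Dsub n c F = lc 1ℚ (D n F) (- c) F

  Dsub-linear : ∀ n c → Linear (Dsub n c)
  Dsub-linear n c =
    (λ F G e → lc-cong 1ℚ (- c) (proj₁ (D-linear n) F G e) e) ,
    (λ a F b G v → trans (cong (λ x → 1ℚ * x + (- c) * (a * F v + b * G v)) (proj₂ (D-linear n) a F b G v))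
                         (ring a b c (D n F v) (D n G v) (F v) (G v)))
    where
    ring : ∀ a b c x y x' y' → 1ℚ * (a * x + b * y) + (- c) * (a * x' + b * y') ≡ a * (1ℚ * x + (- c) * x') + b * (1ℚ * y + (- c) * y')
    ring = solve-∀ ℚ-ring

  Dsub-cong : ∀ n {c c'} F → c ≡ c' → Dsub n c F ≈ Dsub n c' F
  Dsub-cong n F refl v = refl

  Dsub-P : ∀ n c F → Dsub (suc n) (1ℚ + c) (P F) ≈ P (Dsub n c F)
  Dsub-P n c F v = trans (cong (λ x → 1ℚ * x + (- (1ℚ + c)) * P F v) (D-P n F v))
    (trans (ring c (P F v) (P (D n F) v)) (sym (proj₂ P-linear 1ℚ (D n F) (- c) F v)))
    where
    ring : ∀ c x y → 1ℚ * (1ℚ * x + 1ℚ * y) + (- (1ℚ + c)) * x ≡ 1ℚ * y + (- c) * x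
    ring = solve-∀ ℚ-ring

  Dsub-Q : ∀ n c F → Dsub (suc n) c (Q F) ≈ Q (Dsub n (1ℚ + c) F)
  Dsub-Q n c F v = trans (cong (λ x → 1ℚ * x + (- c) * Q F v) (D-Q n F v))
    (trans (ring c (Q F v) (Q (D n F) v)) (sym (proj₂ Q-linear 1ℚ (D n F) (- (1ℚ + c)) F v)))
    where
    ring : ∀ c x y → 1ℚ * ((- 1ℚ) * x + 1ℚ * y) + (- c) * x ≡ 1ℚ * y + (- (1ℚ + c)) * x
    ring = solve-∀ ℚ-ring

  eigenvalue : ℕ → ℕ → ℚ
  eigenvalue n k = ι n - ι k - ι k

  eigenvalue-suc : ∀ n k → eigenvalue (suc n) k ≡ 1ℚ + eigenvalue n k
  eigenvalue-suc n k = ring (ι n) (ι k)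
    where
    ring : ∀ N K → (1ℚ + N) - K - K ≡ 1ℚ + (N - K - K)
    ring = solve-∀ ℚ-ring

  eigenvalue-suc-suc : ∀ n k → 1ℚ + eigenvalue (suc n) (suc k) ≡ eigenvalue n k
  eigenvalue-suc-suc n k = ring (ι n) (ι k)
    where
    ring : ∀ N K → 1ℚ + ((1ℚ + N) - (1ℚ + K) - (1ℚ + K)) ≡ N - K - K
    ring = solve-∀ ℚ-ring

  eigenvalue-zero : ∀ n → 1ℚ + eigenvalue (suc n) 0 ≡ ι (suc (suc n))
  eigenvalue-zero n = ring (ι n)
    where
    ring : ∀ N → 1ℚ + ((1ℚ + N) - 0ℚ - 0ℚ) ≡ 1ℚ + (1ℚ + N)
    ring = solve-∀ ℚ-ring

  annihilator : ℕ → ℕ → Seq → Seq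
  annihilator n zero F = F
  annihilator n (suc k) F = Dsub n (eigenvalue n k) (annihilator n k F)

  annihilator-linear : ∀ n k → Linear (annihilator n k)
  annihilator-linear n zero = (λ F G e → e) , (λ a F b G v → refl)
  annihilator-linear n (suc k) =
    ∘-linear (Dsub n (eigenvalue n k)) (annihilator n k) (Dsub-linear n (eigenvalue n k)) (annihilator-linear n k)

  -- the products intertwine with P and Q (the Q-version absorbs the extra factor D_n − (n+2))
  annihilator-P : ∀ n F k → annihilator (suc n) k (P F) ≈ P (annihilator n k F)
  annihilator-P n F zero v = refl
  annihilator-P n F (suc k) =
    ≈-trans (proj₁ (Dsub-linear (suc n) (eigenvalue (suc n) k)) _ _ (annihilator-P n F k))
    (≈-trans (Dsub-cong (suc n) (P (annihilator n k F)) (eigenvalue-suc n k)) (Dsub-P n (eigenvalue n k) (annihilator n k F)))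

  annihilator-Q : ∀ n F k → annihilator (suc n) (suc k) (Q F) ≈ Q (annihilator n k (Dsub n (ι (suc (suc n))) F))
  annihilator-Q n F zero = ≈-trans (Dsub-Q n (eigenvalue (suc n) 0) F) (proj₁ Q-linear _ _ (Dsub-cong n F (eigenvalue-zero n)))
  annihilator-Q n F (suc k) =
    ≈-trans (proj₁ (Dsub-linear (suc n) (eigenvalue (suc n) (suc k))) _ _ (annihilator-Q n F k))
    (≈-trans (Dsub-Q n (eigenvalue (suc n) (suc k)) _) (proj₁ Q-linear _ _ (Dsub-cong n _ (eigenvalue-suc-suc n k))))

  annihilator-D : ∀ n k F → annihilator n k (D n F) ≈ D n (annihilator n k F)
  annihilator-D n zero F v = refl
  annihilator-D n (suc k) F =
    ≈-trans (proj₁ (Dsub-linear n (eigenvalue n k)) _ _ (annihilator-D n k F))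
            (≈-sym (proj₂ (D-linear n) 1ℚ (D n (annihilator n k F)) (- eigenvalue n k) (annihilator n k F)))

  annihilator-Dsub : ∀ n k c F → annihilator n k (Dsub n c F) ≈ Dsub n c (annihilator n k F)
  annihilator-Dsub n k c F =
    ≈-trans (proj₂ (annihilator-linear n k) 1ℚ (D n F) (- c) F) (lc-cong 1ℚ (- c) (annihilator-D n k F) (λ v → refl))

  Annihilated : ℕ → Seq → Set
  Annihilated n F = annihilator n (suc n) F ≈ 0ₛ

  Annihilated-cong : ∀ n {F G} → F ≈ G → Annihilated n F → Annihilated n G
  Annihilated-cong n e ann = ≈-trans (proj₁ (annihilator-linear n (suc n)) _ _ (≈-sym e)) ann

  Annihilated-lc : ∀ n a F b G → Annihilated n F → Annihilated n G → Annihilated n (lc a F b G)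
  Annihilated-lc n a F b G annF annG =
    ≈-trans (proj₂ (annihilator-linear n (suc n)) a F b G) (≈-trans (lc-cong a b annF annG) (λ v → ring a b))
    where
    ring : ∀ a b → a * 0ℚ + b * 0ℚ ≡ 0ℚ
    ring = solve-∀ ℚ-ring

  Annihilated-P : ∀ n F → Annihilated n F → Annihilated (suc n) (P F)
  Annihilated-P n F ann =
    ≈-trans (proj₁ (Dsub-linear (suc n) c) _ _ (≈-trans (annihilator-P n F (suc n)) (proj₁ P-linear _ _ ann)))
    (≈-trans (proj₁ (Dsub-linear (suc n) c) _ _ (linear-zero P P-linear)) (linear-zero _ (Dsub-linear (suc n) c)))
    where
    c = eigenvalue (suc n) (suc n)

  Annihilated-Q : ∀ n F → Annihilated n F → Annihilated (suc n) (Q F)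
  Annihilated-Q n F ann =
    ≈-trans (annihilator-Q n F (suc n))
    (≈-trans (proj₁ Q-linear _ _ (annihilator-Dsub n (suc n) c F))
    (≈-trans (proj₁ Q-linear _ _ (proj₁ (Dsub-linear n c) _ _ ann))
    (≈-trans (proj₁ Q-linear _ _ (linear-zero _ (Dsub-linear n c))) (linear-zero Q Q-linear))))
    where
    c = ι (suc (suc n))

  X-via-PQ : ∀ F → X F ≈ lc ½ (P F) ½ (Q F)
  X-via-PQ F zero = ring (F 0)
    where
    ring : ∀ a → 0ℚ ≡ ½ * a + ½ * (- a)
    ring = solve-∀ ℚ-ring
  X-via-PQ F (suc v) = ring (F v) (F (suc v))
    where
    ring : ∀ a b → a ≡ ½ * (a + b) + ½ * (a - b)
    ring = solve-∀ ℚ-ring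

  id-via-PQ : ∀ F → F ≈ lc ½ (P F) (- ½) (Q F)
  id-via-PQ F zero = ring (F 0)
    where
    ring : ∀ a → a ≡ ½ * a + (- ½) * (- a)
    ring = solve-∀ ℚ-ring
  id-via-PQ F (suc v) = ring (F v) (F (suc v))
    where
    ring : ∀ a b → b ≡ ½ * (a + b) + (- ½) * (a - b)
    ring = solve-∀ ℚ-ring

  Annihilated-X : ∀ n F → Annihilated n F → Annihilated (suc n) (X F)
  Annihilated-X n F ann = Annihilated-cong (suc n) (≈-sym (X-via-PQ F))
    (Annihilated-lc (suc n) ½ (P F) ½ (Q F) (Annihilated-P n F ann) (Annihilated-Q n F ann))

  Annihilated-suc : ∀ n F → Annihilated n F → Annihilated (suc n) F
  Annihilated-suc n F ann = Annihilated-cong (suc n) (≈-sym (id-via-PQ F))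
    (Annihilated-lc (suc n) ½ (P F) (- ½) (Q F) (Annihilated-P n F ann) (Annihilated-Q n F ann))

  δ₀ : Seq
  δ₀ zero = 1ℚ
  δ₀ (suc _) = 0ℚ

  D₀-δ₀ : D 0 δ₀ ≈ 0ₛ
  D₀-δ₀ zero = refl
  D₀-δ₀ (suc zero) = refl
  D₀-δ₀ (suc (suc w)) = ring (ι (suc w)) (ι (suc (suc (suc w))))
    where
    ring : ∀ a b → (0ℚ - a) * 0ℚ + b * 0ℚ ≡ 0ℚ
    ring = solve-∀ ℚ-ring

  Annihilated-δ₀ : ∀ n → Annihilated n δ₀
  Annihilated-δ₀ zero v = trans (cong (λ x → 1ℚ * x + (- eigenvalue 0 0) * δ₀ v) (D₀-δ₀ v)) (ring (δ₀ v))
    where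
    ring : ∀ x → 1ℚ * 0ℚ + (- (0ℚ - 0ℚ - 0ℚ)) * x ≡ 0ℚ
    ring = solve-∀ ℚ-ring
  Annihilated-δ₀ (suc n) = Annihilated-suc n δ₀ (Annihilated-δ₀ n)

  -- Cayley–Hamilton for D_n: write F = F(0)·1 + x·(F shifted) and induct on n
  Cayley-Hamilton : ∀ n F → SupportedIn n F → Annihilated n F
  Cayley-Hamilton zero F supp = Annihilated-cong 0 (≈-sym constant) (Annihilated-lc 0 (F 0) δ₀ 0ℚ δ₀ (Annihilated-δ₀ 0) (Annihilated-δ₀ 0))
    where
    ring₀ : ∀ a → a ≡ a * 1ℚ + 0ℚ * 1ℚ
    ring₀ = solve-∀ ℚ-ring
    ring₁ : ∀ a → 0ℚ ≡ a * 0ℚ + 0ℚ * 0ℚ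
    ring₁ = solve-∀ ℚ-ring
    constant : F ≈ lc (F 0) δ₀ 0ℚ δ₀
    constant zero = ring₀ (F 0)
    constant (suc v) = trans (supp (suc v) (ℕ.s≤s ℕ.z≤n)) (ring₁ (F 0))
  Cayley-Hamilton (suc n) F supp = Annihilated-cong (suc n) (≈-sym split)
      (Annihilated-lc (suc n) (F 0) δ₀ 1ℚ (X tail) (Annihilated-δ₀ (suc n))
        (Annihilated-X n tail (Cayley-Hamilton n tail (λ v n<v → supp (suc v) (ℕ.s≤s n<v)))))
    where
    tail : Seq
    tail v = F (suc v)
    ring₀ : ∀ a → a ≡ a * 1ℚ + 1ℚ * 0ℚ
    ring₀ = solve-∀ ℚ-ring
    ring₁ : ∀ a b → b ≡ a * 0ℚ + 1ℚ * b
    ring₁ = solve-∀ ℚ-ring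
    split : F ≈ lc (F 0) δ₀ 1ℚ (X tail)
    split zero = ring₀ (F 0)
    split (suc v) = ring₁ (F 0) (F (suc v))

  -- If D_n² = n on F, then Π_{j<k} (D_n − λ_j) F = α_k F + β_k D_n F, where α_k + β_k √n
  -- is Π_{j<k} (√n − λ_j); its norm α_k² − n β_k² is Π_{j<k} (λ_j² − n).
  reduced : ℕ → ℕ → ℚ × ℚ
  reduced n zero = 1ℚ , 0ℚ
  reduced n (suc k) = let (α , β) = reduced n k ; λₖ = eigenvalue n k in
    β * ι n - λₖ * α , α - λₖ * β

  norm : ℕ → ℕ → ℚ
  norm n k = let (α , β) = reduced n k in α * α - ι n * (β * β)

  norm-suc : ∀ n k → norm n (suc k) ≡ (eigenvalue n k * eigenvalue n k - ι n) * norm n k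
  norm-suc n k = ring (proj₁ (reduced n k)) (proj₂ (reduced n k)) (eigenvalue n k) (ι n)
    where
    ring : ∀ a b l N → (b * N - l * a) * (b * N - l * a) - N * ((a - l * b) * (a - l * b)) ≡ (l * l - N) * (a * a - N * (b * b))
    ring = solve-∀ ℚ-ring

  annihilator-reduced : ∀ n F → D n (D n F) ≈ scale (ι n) F → ∀ k →
    annihilator n k F ≈ lc (proj₁ (reduced n k)) F (proj₂ (reduced n k)) (D n F)
  annihilator-reduced n F D²F zero v = ring (F v) (D n F v)
    where
    ring : ∀ x y → x ≡ 1ℚ * x + 0ℚ * y
    ring = solve-∀ ℚ-ring
  annihilator-reduced n F D²F (suc k) v =
    trans (cong₂ (λ x y → 1ℚ * x + (- eigenvalue n k) * y)
            (trans (proj₁ (D-linear n) _ _ (annihilator-reduced n F D²F k) v)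
              (trans (proj₂ (D-linear n) α F β (D n F) v) (cong (λ z → α * D n F v + β * z) (D²F v))))
            (annihilator-reduced n F D²F k v))
      (ring α β (eigenvalue n k) (ι n) (F v) (D n F v))
    where
    α = proj₁ (reduced n k)
    β = proj₂ (reduced n k)
    ring : ∀ a b l N x y → 1ℚ * (a * y + b * (N * x)) + (- l) * (a * x + b * y) ≡ (b * N - l * a) * x + (a - l * b) * y
    ring = solve-∀ ℚ-ring

  norm-nonzero : ∀ n → (∀ k → k ℕ.≤ n → ¬ (eigenvalue n k * eigenvalue n k ≡ ι n)) → ∀ k → k ℕ.≤ suc n → ¬ (norm n k ≡ 0ℚ)
  norm-nonzero n noRoot zero _ e = 0≢1 (sym (trans (sym (ring (ι n))) e))
    where
    ring : ∀ N → 1ℚ * 1ℚ - N * (0ℚ * 0ℚ) ≡ 1ℚ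
    ring = solve-∀ ℚ-ring
  norm-nonzero n noRoot (suc k) (ℕ.s≤s k≤n) e =
    norm-nonzero n noRoot k (NP.m≤n⇒m≤1+n k≤n)
      (cancel-nonzero (λₖ * λₖ - ι n) (norm n k) (trans (sym (norm-suc n k)) e) factor-nonzero)
    where
    λₖ = eigenvalue n k
    ring : ∀ a N → (a - N) + N ≡ a
    ring = solve-∀ ℚ-ring
    ring₀ : ∀ N → 0ℚ + N ≡ N
    ring₀ = solve-∀ ℚ-ring
    factor-nonzero : ¬ (λₖ * λₖ - ι n ≡ 0ℚ)
    factor-nonzero e' = noRoot k k≤n (trans (sym (ring (λₖ * λₖ) (ι n))) (trans (cong (_+ ι n) e') (ring₀ (ι n))))

  D²≈n-trivial : ∀ n F → SupportedIn n F → D n (D n F) ≈ scale (ι n) F →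
                 (∀ k → k ℕ.≤ n → ¬ (eigenvalue n k * eigenvalue n k ≡ ι n)) → F ≈ 0ₛ
  D²≈n-trivial n F supp D²F noRoot v =
    cancel-nonzero (norm n (suc n)) (F v) normF≡0 (norm-nonzero n noRoot (suc n) NP.≤-refl)
    where
    α = proj₁ (reduced n (suc n))
    β = proj₂ (reduced n (suc n))
    αF+βDF≡0 : ∀ v → α * F v + β * D n F v ≡ 0ℚ
    αF+βDF≡0 v = trans (sym (annihilator-reduced n F D²F (suc n) v)) (Cayley-Hamilton n F supp v)
    αDF+βnF≡0 : α * D n F v + β * (ι n * F v) ≡ 0ℚ
    αDF+βnF≡0 = trans (sym (trans (proj₂ (D-linear n) α F β (D n F) v) (cong (λ z → α * D n F v + β * z) (D²F v))))
                      (trans (proj₁ (D-linear n) _ 0ₛ αF+βDF≡0 v) (linear-zero (D n) (D-linear n) v))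
    ring : ∀ a b N x y → (a * a - N * (b * b)) * x ≡ a * (a * x + b * y) - b * (a * y + b * (N * x))
    ring = solve-∀ ℚ-ring
    ring₀ : ∀ a b → a * 0ℚ - b * 0ℚ ≡ 0ℚ
    ring₀ = solve-∀ ℚ-ring
    normF≡0 : norm n (suc n) * F v ≡ 0ℚ
    normF≡0 = trans (ring α β (ι n) (F v) (D n F v)) (trans (cong₂ (λ x y → α * x - β * y) (αF+βDF≡0 v) αDF+βnF≡0) (ring₀ α β))

  Qpow : ℕ → Seq
  Qpow zero = δ₀
  Qpow (suc b) = Q (Qpow b)

  Ppow : ℕ → Seq → Seq
  Ppow zero G = G
  Ppow (suc m) G = P (Ppow m G)

  Qpow-eigen : ∀ b → D b (Qpow b) ≈ scale (- ι b) (Qpow b)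
  Qpow-eigen zero v = trans (D₀-δ₀ v) (sym (ring (δ₀ v)))
    where
    ring : ∀ x → (- 0ℚ) * x ≡ 0ℚ
    ring = solve-∀ ℚ-ring
  Qpow-eigen (suc b) v = trans (D-Q b G v) (trans (cong (λ z → (- 1ℚ) * Q G v + 1ℚ * z)
       (trans (proj₁ Q-linear _ _ (Qpow-eigen b) v) (linear-scale Q Q-linear (- ι b) G v))) (ring (ι b) (Q G v)))
    where
    G = Qpow b
    ring : ∀ B x → (- 1ℚ) * x + 1ℚ * ((- B) * x) ≡ (- (1ℚ + B)) * x
    ring = solve-∀ ℚ-ring

  Ppow-eigen : ∀ b G → D b G ≈ scale (- ι b) G → ∀ m → D (m ℕ.+ b) (Ppow m G) ≈ scale (ι m - ι b) (Ppow m G)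
  Ppow-eigen b G eig zero v = trans (eig v) (ring (ι b) (G v))
    where
    ring : ∀ B x → (- B) * x ≡ (0ℚ - B) * x
    ring = solve-∀ ℚ-ring
  Ppow-eigen b G eig (suc m) v = trans (D-P (m ℕ.+ b) K v) (trans (cong (λ z → 1ℚ * P K v + 1ℚ * z)
       (trans (proj₁ P-linear _ _ (Ppow-eigen b G eig m) v) (linear-scale P P-linear (ι m - ι b) K v))) (ring (ι m) (ι b) (P K v)))
    where
    K = Ppow m G
    ring : ∀ M B x → 1ℚ * x + 1ℚ * ((M - B) * x) ≡ ((1ℚ + M) - B) * x
    ring = solve-∀ ℚ-ring

  kacEigenvector : ℕ → ℕ → Seq
  kacEigenvector m b = Ppow m (Qpow b)

  kacEigenvector-D² : ∀ m b → D (m ℕ.+ b) (D (m ℕ.+ b) (kacEigenvector m b)) ≈ scale ((ι m - ι b) * (ι m - ι b)) (kacEigenvector m b)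
  kacEigenvector-D² m b v =
    trans (proj₁ (D-linear (m ℕ.+ b)) _ _ (Ppow-eigen b (Qpow b) (Qpow-eigen b) m) v)
    (trans (linear-scale (D (m ℕ.+ b)) (D-linear (m ℕ.+ b)) c (kacEigenvector m b) v)
    (trans (cong (c *_) (Ppow-eigen b (Qpow b) (Qpow-eigen b) m v)) (sym (*-assoc c c (kacEigenvector m b v)))))
    where
    c = ι m - ι b

  kacEigenvector-0 : ∀ m b → kacEigenvector m b 0 * kacEigenvector m b 0 ≡ 1ℚ
  kacEigenvector-0 zero zero = refl
  kacEigenvector-0 zero (suc b) = trans (ring (Qpow b 0)) (kacEigenvector-0 zero b)
    where
    ring : ∀ x → (- x) * (- x) ≡ x * x
    ring = solve-∀ ℚ-ring
  kacEigenvector-0 (suc m) b = kacEigenvector-0 m b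

  P-supported : ∀ k G → SupportedIn k G → SupportedIn (suc k) (P G)
  P-supported k G supp (suc v) (ℕ.s≤s k<v) = cong₂ _+_ (supp v k<v) (supp (suc v) (NP.m≤n⇒m≤1+n k<v))

  Q-supported : ∀ k G → SupportedIn k G → SupportedIn (suc k) (Q G)
  Q-supported k G supp (suc v) (ℕ.s≤s k<v) = cong₂ _-_ (supp v k<v) (supp (suc v) (NP.m≤n⇒m≤1+n k<v))

  kacEigenvector-supported : ∀ m b → SupportedIn (m ℕ.+ b) (kacEigenvector m b)
  kacEigenvector-supported zero zero (suc v) _ = refl
  kacEigenvector-supported zero (suc b) = Q-supported b (Qpow b) (kacEigenvector-supported zero b)
  kacEigenvector-supported (suc m) b = P-supported (m ℕ.+ b) (kacEigenvector m b) (kacEigenvector-supported m b)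

  -- D_n preserves degree ≤ n (the coefficient n − (v−1) vanishes at v = n+1)
  D-supported : ∀ n F → SupportedIn n F → SupportedIn n (D n F)
  D-supported n F supp (suc v) (ℕ.s≤s n≤v) with NP.m≤n⇒m<n∨m≡n n≤v
  ... | inj₁ n<v =
    trans (cong₂ (λ x y → (ι n - ι v) * x + ι (suc (suc v)) * y) (supp v n<v) (supp (suc (suc v)) (NP.m≤n⇒m≤1+n (NP.m≤n⇒m≤1+n n<v))))
          (ring (ι n - ι v) (ι (suc (suc v))))
    where
    ring : ∀ a b → a * 0ℚ + b * 0ℚ ≡ 0ℚ
    ring = solve-∀ ℚ-ring
  ... | inj₂ refl =
    trans (cong (λ y → (ι n - ι n) * F n + ι (suc (suc n)) * y) (supp (suc (suc n)) (NP.m≤n⇒m≤1+n (ℕ.s≤s NP.≤-refl))))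
          (ring (ι n) (F n) (ι (suc (suc n))))
    where
    ring : ∀ a x b → (a - a) * x + b * 0ℚ ≡ 0ℚ
    ring = solve-∀ ℚ-ring

-- Binomial conjugation: with F(v) = C(n,v)·f(v), the Kac operator becomes
-- A_n f(v) = v·f(v−1) + (n−v)·f(v+1), and A_n² = n + 2·Tsum_n, where Tsum_n f(s)
-- is the value of Σ_w f(w)·T_w at words of weight s.
module Bridge where

  open import Data.Nat as ℕ using (ℕ; zero; suc; _∸_; _≡ᵇ_; ∣_-_∣)
  import Data.Nat.Properties as NP
  import Data.Nat.Tactic.RingSolver as ℕ-Solver
  open import Data.Integer as ℤ using (ℤ)
  import Data.Integer.Properties as ℤP
  import Data.Integer.Tactic.RingSolver as ℤ-Solver
  open import Data.Rational as ℚ using (ℚ; 0ℚ; 1ℚ; _+_; _*_; _-_; -_)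
  open import Data.Rational.Properties using (toℚᵘ-injective; toℚᵘ-fromℚᵘ; toℚᵘ-homo-+; fromℚᵘ-injective; *-zeroʳ; *-zeroˡ)
  import Data.Rational.Unnormalised as ℚᵘ
  import Data.Rational.Unnormalised.Properties as ℚᵘP
  open import Data.Fin using (Fin; zero; suc; toℕ)
  open import Data.Vec using (Vec)
  open import Data.Bool as Bool using (Bool)
  open import Data.List using ([]; _∷_)
  open import Relation.Binary.PropositionalEquality
  open import Relation.Nullary using (¬_)
  open import Data.Product using (proj₁)
  open import Tactic.RingSolver using (solve-∀)
  open import Defs using (sumℚ; linComb; Tfamily; T; Tcoeff; weight)
  open Kac
  open Counting using (choose2; ⟦_⟧; twoFlipCount; Tcoeff-formula)

  _/1 : ℤ → ℚ
  a /1 = a ℚ./ 1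

  /1-+ : ∀ a b → (a ℤ.+ b) /1 ≡ a /1 + b /1
  /1-+ a b = toℚᵘ-injective (ℚᵘP.≃-trans (toℚᵘ-fromℚᵘ (ℚᵘ.mkℚᵘ (a ℤ.+ b) 0))
     (ℚᵘP.≃-sym (ℚᵘP.≃-trans (toℚᵘ-homo-+ (a /1) (b /1))
       (ℚᵘP.≃-trans (ℚᵘP.+-cong (toℚᵘ-fromℚᵘ (ℚᵘ.mkℚᵘ a 0)) (toℚᵘ-fromℚᵘ (ℚᵘ.mkℚᵘ b 0))) (ℚᵘ.*≡* cross)))))
    where
    cross : (a ℤ.* ℤ.+ 1 ℤ.+ b ℤ.* ℤ.+ 1) ℤ.* ℤ.+ 1 ≡ (a ℤ.+ b) ℤ.* ℤ.+ 1
    cross = ℤ-Solver.solve (a ∷ b ∷ [])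

  /1-injective : ∀ a b → a /1 ≡ b /1 → a ≡ b
  /1-injective a b e with fromℚᵘ-injective {ℚᵘ.mkℚᵘ a 0} {ℚᵘ.mkℚᵘ b 0} e
  ... | ℚᵘ.*≡* cross = trans (sym (ℤP.*-identityʳ a)) (trans cross (ℤP.*-identityʳ b))

  ι≡/1 : ∀ k → ι k ≡ (ℤ.+ k) /1
  ι≡/1 zero = refl
  ι≡/1 (suc k) = trans (cong (1ℚ +_) (ι≡/1 k)) (sym (/1-+ (ℤ.+ 1) (ℤ.+ k)))

  ι-injective : ∀ a b → ι a ≡ ι b → a ≡ b
  ι-injective a b e = ℤP.+-injective (/1-injective (ℤ.+ a) (ℤ.+ b) (trans (sym (ι≡/1 a)) (trans e (ι≡/1 b))))

  ι-suc-nonzero : ∀ x → ¬ (ι (suc x) ≡ 0ℚ)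
  ι-suc-nonzero x e with ι-injective (suc x) 0 e
  ... | ()

  ι-∸ : ∀ {n s} → s ℕ.≤ n → ι (n ∸ s) ≡ ι n - ι s
  ι-∸ {n} {s} s≤n = trans (sym (ring (ι (n ∸ s)) (ι s))) (cong (_- ι s) (trans (sym (ι-+ (n ∸ s) s)) (cong ι (NP.m∸n+n≡m s≤n))))
    where
    ring : ∀ a b → (a + b) - b ≡ a
    ring = solve-∀ ℚ-ring

  ι-dist² : ∀ a b → (ι a - ι b) * (ι a - ι b) ≡ ι (∣ a - b ∣ ℕ.* ∣ a - b ∣)
  ι-dist² zero b = trans (ring (ι b)) (sym (ι-* b b))
    where
    ring : ∀ y → (0ℚ - y) * (0ℚ - y) ≡ y * y
    ring = solve-∀ ℚ-ring
  ι-dist² (suc a) zero = trans (ring (ι (suc a))) (sym (ι-* (suc a) (suc a)))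
    where
    ring : ∀ x → (x - 0ℚ) * (x - 0ℚ) ≡ x * x
    ring = solve-∀ ℚ-ring
  ι-dist² (suc a) (suc b) = trans (ring (ι a) (ι b)) (ι-dist² a b)
    where
    ring : ∀ x y → ((1ℚ + x) - (1ℚ + y)) * ((1ℚ + x) - (1ℚ + y)) ≡ (x - y) * (x - y)
    ring = solve-∀ ℚ-ring

  binomial : ℕ → ℕ → ℕ
  binomial zero zero = 1
  binomial zero (suc k) = 0
  binomial (suc n) zero = 1
  binomial (suc n) (suc k) = binomial n k ℕ.+ binomial n (suc k)

  binomial-zero : ∀ n → binomial n 0 ≡ 1
  binomial-zero zero = refl
  binomial-zero (suc n) = refl

  binomial-beyond : ∀ n k → n ℕ.< k → binomial n k ≡ 0
  binomial-beyond zero (suc k) _ = refl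
  binomial-beyond (suc n) (suc k) (ℕ.s≤s n<k) = cong₂ ℕ._+_ (binomial-beyond n k n<k) (binomial-beyond n (suc k) (NP.m≤n⇒m≤1+n n<k))

  binomial-positive : ∀ n k → k ℕ.≤ n → 1 ℕ.≤ binomial n k
  binomial-positive n zero _ = NP.≤-reflexive (sym (binomial-zero n))
  binomial-positive (suc n) (suc k) (ℕ.s≤s k≤n) = NP.≤-trans (binomial-positive n k k≤n) (NP.m≤m+n (binomial n k) (binomial n (suc k)))

  binomial-absorption : ∀ n k → suc k ℕ.* binomial n (suc k) ℕ.+ k ℕ.* binomial n k ≡ n ℕ.* binomial n k
  binomial-absorption zero zero = refl
  binomial-absorption zero (suc k) = ring k
    where
    ring : ∀ k → suc (suc k) ℕ.* 0 ℕ.+ suc k ℕ.* 0 ≡ 0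
    ring = ℕ-Solver.solve-∀
  binomial-absorption (suc n) zero rewrite binomial-zero n = trans (ring₁ x) (trans (cong suc IH) (ring₂ n))
    where
    x = binomial n 1
    IH : 1 ℕ.* x ℕ.+ 0 ℕ.* 1 ≡ n ℕ.* 1
    IH = subst (λ z → 1 ℕ.* x ℕ.+ 0 ℕ.* z ≡ n ℕ.* z) (binomial-zero n) (binomial-absorption n 0)
    ring₁ : ∀ x → 1 ℕ.* (1 ℕ.+ x) ℕ.+ 0 ℕ.* 1 ≡ suc (1 ℕ.* x ℕ.+ 0 ℕ.* 1)
    ring₁ = ℕ-Solver.solve-∀
    ring₂ : ∀ n → suc (n ℕ.* 1) ≡ suc n ℕ.* 1
    ring₂ = ℕ-Solver.solve-∀
  binomial-absorption (suc n) (suc j) =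
    trans (ring₁ j a b c) (trans (cong₂ (λ x y → x ℕ.+ b ℕ.+ y ℕ.+ a) (binomial-absorption n (suc j)) (binomial-absorption n j)) (ring₂ n a b))
    where
    a = binomial n j
    b = binomial n (suc j)
    c = binomial n (suc (suc j))
    ring₁ : ∀ j a b c → suc (suc j) ℕ.* (b ℕ.+ c) ℕ.+ suc j ℕ.* (a ℕ.+ b) ≡ (suc (suc j) ℕ.* c ℕ.+ suc j ℕ.* b) ℕ.+ b ℕ.+ (suc j ℕ.* b ℕ.+ j ℕ.* a) ℕ.+ a
    ring₁ = ℕ-Solver.solve-∀
    ring₂ : ∀ n a b → n ℕ.* b ℕ.+ b ℕ.+ n ℕ.* a ℕ.+ a ≡ suc n ℕ.* (a ℕ.+ b)
    ring₂ = ℕ-Solver.solve-∀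

  C : ℕ → ℕ → ℚ
  C n k = ι (binomial n k)

  C-nonzero : ∀ n k → k ℕ.≤ n → ¬ (C n k ≡ 0ℚ)
  C-nonzero n k k≤n with binomial n k | binomial-positive n k k≤n
  ... | suc b | _ = ι-suc-nonzero b

  C-absorption : ∀ n k → ι (suc k) * C n (suc k) ≡ (ι n - ι k) * C n k
  C-absorption n k = trans (sym (ring₁ (ι (suc k) * C n (suc k)) (ι k * C n k)))
    (trans (cong (_- ι k * C n k) inℕ) (ring₂ (ι n) (ι k) (C n k)))
    where
    inℕ : ι (suc k) * C n (suc k) + ι k * C n k ≡ ι n * C n k
    inℕ = trans (sym (cong₂ _+_ (ι-* (suc k) (binomial n (suc k))) (ι-* k (binomial n k))))
          (trans (sym (ι-+ (suc k ℕ.* binomial n (suc k)) (k ℕ.* binomial n k)))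
            (trans (cong ι (binomial-absorption n k)) (ι-* n (binomial n k))))
    ring₁ : ∀ x y → (x + y) - y ≡ x
    ring₁ = solve-∀ ℚ-ring
    ring₂ : ∀ N K c → N * c - K * c ≡ (N - K) * c
    ring₂ = solve-∀ ℚ-ring

  withBinomial : ℕ → Seq → Seq
  withBinomial n f v = C n v * f v

  withBinomial-supported : ∀ n f → SupportedIn n (withBinomial n f)
  withBinomial-supported n f v n<v = trans (cong (λ z → ι z * f v) (binomial-beyond n v n<v)) (*-zeroˡ (f v))

  A : ℕ → Seq → Seq
  A n f zero = (ι n - 0ℚ) * f 1
  A n f (suc v) = ι (suc v) * f v + (ι n - ι (suc v)) * f (suc (suc v))

  D-withBinomial : ∀ n f → D n (withBinomial n f) ≈ withBinomial n (A n f)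
  D-withBinomial n f zero = trans (ring₁ (C n 1) (f 1)) (trans (cong (_* f 1) (C-absorption n 0)) (ring₂ (ι n) (C n 0) (f 1)))
    where
    ring₁ : ∀ c x → c * x ≡ ((1ℚ + 0ℚ) * c) * x
    ring₁ = solve-∀ ℚ-ring
    ring₂ : ∀ N c x → ((N - 0ℚ) * c) * x ≡ c * ((N - 0ℚ) * x)
    ring₂ = solve-∀ ℚ-ring
  D-withBinomial n f (suc v) =
    trans (ring₁ (ι n - ι v) (ι (suc (suc v))) (C n v) (C n (suc (suc v))) (f v) (f (suc (suc v))))
    (trans (cong₂ (λ x y → x * f v + y * f (suc (suc v))) (sym (C-absorption n v)) (C-absorption n (suc v)))
      (ring₂ (ι (suc v)) (ι n - ι (suc v)) (C n (suc v)) (f v) (f (suc (suc v)))))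
    where
    ring₁ : ∀ a b c₀ c₂ x y → a * (c₀ * x) + b * (c₂ * y) ≡ (a * c₀) * x + (b * c₂) * y
    ring₁ = solve-∀ ℚ-ring
    ring₂ : ∀ a b c x y → (a * c) * x + (b * c) * y ≡ c * (a * x + b * y)
    ring₂ = solve-∀ ℚ-ring

  D²-withBinomial : ∀ n f → D n (D n (withBinomial n f)) ≈ withBinomial n (A n (A n f))
  D²-withBinomial n f v = trans (proj₁ (D-linear n) _ (withBinomial n (A n f)) (D-withBinomial n f) v) (D-withBinomial n (A n f) v)

  shift₂ : Seq → Seq
  shift₂ f zero = 0ℚ
  shift₂ f (suc zero) = 0ℚ
  shift₂ f (suc (suc w)) = f w

  -- Σ_w f(w)·T_w at a word of weight s, by the coefficient formula
  Tsum : ℕ → Seq → ℕ → ℚ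
  Tsum n f s = ι (choose2 s) * shift₂ f s + ι (s ℕ.* (n ∸ s)) * f s + ι (choose2 (n ∸ s)) * f (suc (suc s))

  choose2-ι : ∀ m → (1ℚ + 1ℚ) * ι (choose2 m) ≡ ι m * (ι m - 1ℚ)
  choose2-ι zero = refl
  choose2-ι (suc m) =
    trans (cong ((1ℚ + 1ℚ) *_) (ι-+ m (choose2 m)))
    (trans (ring₁ (ι m) (ι (choose2 m))) (trans (cong (λ z → (1ℚ + 1ℚ) * ι m + z) (choose2-ι m)) (ring₂ (ι m))))
    where
    ring₁ : ∀ a b → (1ℚ + 1ℚ) * (a + b) ≡ (1ℚ + 1ℚ) * a + (1ℚ + 1ℚ) * b
    ring₁ = solve-∀ ℚ-ring
    ring₂ : ∀ a → (1ℚ + 1ℚ) * a + a * (a - 1ℚ) ≡ (1ℚ + a) * ((1ℚ + a) - 1ℚ)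
    ring₂ = solve-∀ ℚ-ring

  A² : ∀ n f v → v ℕ.≤ n → A n (A n f) v ≡ ι n * f v + (1ℚ + 1ℚ) * Tsum n f v
  A² n f zero _ =
    sym (trans (ring₁ (ι n) (ι (choose2 n)) (f 0) (f 2)) (trans (cong (λ z → ι n * f 0 + z * f 2) (choose2-ι n)) (ring₂ (ι n) (f 0) (f 2))))
    where
    ring₁ : ∀ N c x y → N * x + (1ℚ + 1ℚ) * (0ℚ * 0ℚ + 0ℚ * x + c * y) ≡ N * x + ((1ℚ + 1ℚ) * c) * y
    ring₁ = solve-∀ ℚ-ring
    ring₂ : ∀ N x y → N * x + (N * (N - 1ℚ)) * y ≡ (N - 0ℚ) * ((1ℚ + 0ℚ) * x + (N - (1ℚ + 0ℚ)) * y)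
    ring₂ = solve-∀ ℚ-ring
  A² n f (suc zero) 1≤n =
    sym (trans (ring₁ (ι n) (ι (1 ℕ.* (n ∸ 1))) (ι (choose2 (n ∸ 1))) (f 1) (f 3))
      (trans (cong₂ (λ a b → ι n * f 1 + (1ℚ + 1ℚ) * a * f 1 + b * f 3)
                    (trans (ι-* 1 (n ∸ 1)) (cong (ι 1 *_) (ι-∸ 1≤n)))
                    (trans (choose2-ι (n ∸ 1)) (cong (λ z → z * (z - 1ℚ)) (ι-∸ 1≤n))))
      (ring₂ (ι n) (f 1) (f 3))))
    where
    ring₁ : ∀ N p c x y → N * x + (1ℚ + 1ℚ) * (0ℚ * 0ℚ + p * x + c * y) ≡ N * x + (1ℚ + 1ℚ) * p * x + ((1ℚ + 1ℚ) * c) * y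
    ring₁ = solve-∀ ℚ-ring
    ring₂ : ∀ N x y → N * x + (1ℚ + 1ℚ) * ((1ℚ + 0ℚ) * (N - (1ℚ + 0ℚ))) * x + ((N - (1ℚ + 0ℚ)) * ((N - (1ℚ + 0ℚ)) - 1ℚ)) * y
       ≡ (1ℚ + 0ℚ) * ((N - 0ℚ) * x) + (N - (1ℚ + 0ℚ)) * ((1ℚ + (1ℚ + 0ℚ)) * x + (N - (1ℚ + (1ℚ + 0ℚ))) * y)
    ring₂ = solve-∀ ℚ-ring
  A² n f (suc (suc w)) v≤n =
    sym (trans (ring₁ (ι n) (ι (choose2 v)) (ι (v ℕ.* (n ∸ v))) (ι (choose2 (n ∸ v))) (f w) (f v) (f (suc (suc v))))
      (trans (cong₃ (choose2-ι v) (trans (ι-* v (n ∸ v)) (cong (ι v *_) (ι-∸ v≤n)))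
                    (trans (choose2-ι (n ∸ v)) (cong (λ z → z * (z - 1ℚ)) (ι-∸ v≤n))))
      (ring₂ (ι n) (ι w) (f w) (f v) (f (suc (suc v))))))
    where
    v = suc (suc w)
    cong₃ : ∀ {a a' b b' c c'} → a ≡ a' → b ≡ b' → c ≡ c' →
            ι n * f v + a * f w + (1ℚ + 1ℚ) * b * f v + c * f (suc (suc v)) ≡ ι n * f v + a' * f w + (1ℚ + 1ℚ) * b' * f v + c' * f (suc (suc v))
    cong₃ refl refl refl = refl
    ring₁ : ∀ N a p c x y z → N * y + (1ℚ + 1ℚ) * (a * x + p * y + c * z) ≡ N * y + ((1ℚ + 1ℚ) * a) * x + (1ℚ + 1ℚ) * p * y + ((1ℚ + 1ℚ) * c) * z
    ring₁ = solve-∀ ℚ-ring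
    ring₂ : ∀ N W x y z →
       N * y + ((1ℚ + (1ℚ + W)) * ((1ℚ + (1ℚ + W)) - 1ℚ)) * x + (1ℚ + 1ℚ) * ((1ℚ + (1ℚ + W)) * (N - (1ℚ + (1ℚ + W)))) * y
         + ((N - (1ℚ + (1ℚ + W))) * ((N - (1ℚ + (1ℚ + W))) - 1ℚ)) * z
       ≡ (1ℚ + (1ℚ + W)) * ((1ℚ + W) * x + (N - (1ℚ + W)) * y) + (N - (1ℚ + (1ℚ + W))) * ((1ℚ + (1ℚ + (1ℚ + W))) * y + (N - (1ℚ + (1ℚ + (1ℚ + W)))) * z)
    ring₂ = solve-∀ ℚ-ring

  sumℚ-cong : ∀ r (f g : Fin r → ℚ) → (∀ i → f i ≡ g i) → sumℚ r f ≡ sumℚ r g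
  sumℚ-cong zero f g e = refl
  sumℚ-cong (suc r) f g e = cong₂ _+_ (e zero) (sumℚ-cong r _ _ (λ i → e (suc i)))

  sumℚ-+ : ∀ r (f g : Fin r → ℚ) → sumℚ r (λ i → f i + g i) ≡ sumℚ r f + sumℚ r g
  sumℚ-+ zero f g = refl
  sumℚ-+ (suc r) f g =
    trans (cong ((f zero + g zero) +_) (sumℚ-+ r _ _)) (ring (f zero) (g zero) (sumℚ r (λ i → f (suc i))) (sumℚ r (λ i → g (suc i))))
    where
    ring : ∀ a b c d → (a + b) + (c + d) ≡ (a + c) + (b + d)
    ring = solve-∀ ℚ-ring

  sumℚ-zero : ∀ r (f : Fin r → ℚ) → (∀ i → f i ≡ 0ℚ) → sumℚ r f ≡ 0ℚ
  sumℚ-zero zero f e = refl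
  sumℚ-zero (suc r) f e = trans (cong₂ _+_ (e zero) (sumℚ-zero r _ (λ i → e (suc i)))) refl

  onEvens : ∀ {r} → (Fin r → ℚ) → Seq
  onEvens {zero} c v = 0ℚ
  onEvens {suc r} c zero = c zero
  onEvens {suc r} c (suc zero) = 0ℚ
  onEvens {suc r} c (suc (suc v)) = onEvens (λ i → c (suc i)) v

  double-suc : ∀ a → 2 ℕ.* suc a ≡ suc (suc (2 ℕ.* a))
  double-suc = ℕ-Solver.solve-∀

  onEvens-even : ∀ {r} (c : Fin r → ℚ) i → onEvens c (2 ℕ.* toℕ i) ≡ c i
  onEvens-even c zero = refl
  onEvens-even c (suc i) = trans (cong (onEvens c) (double-suc (toℕ i))) (onEvens-even (λ i → c (suc i)) i)

  onEvens-odd : ∀ {r} (c : Fin r → ℚ) a → onEvens c (suc (2 ℕ.* a)) ≡ 0ℚ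
  onEvens-odd {zero} c a = refl
  onEvens-odd {suc r} c zero = refl
  onEvens-odd {suc r} c (suc a) = trans (cong (λ m → onEvens c (suc m)) (double-suc a)) (onEvens-odd (λ i → c (suc i)) a)

  onEvens-beyond : ∀ {r} (c : Fin r → ℚ) a → r ℕ.≤ a → onEvens c (2 ℕ.* a) ≡ 0ℚ
  onEvens-beyond {zero} c a _ = refl
  onEvens-beyond {suc r} c (suc a) (ℕ.s≤s r≤a) = trans (cong (onEvens c) (double-suc a)) (onEvens-beyond (λ i → c (suc i)) a r≤a)

  sift : ∀ {r} (c : Fin r → ℚ) t K → sumℚ r (λ i → c i * ι (⟦ t ≡ᵇ 2 ℕ.* toℕ i ⟧ ℕ.* K)) ≡ onEvens c t * ι K
  sift {zero} c t K = sym (*-zeroˡ (ι K))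
  sift {suc r} c t K =
    trans (cong (c zero * ι (⟦ t ≡ᵇ 0 ⟧ ℕ.* K) +_)
            (sumℚ-cong r _ _ (λ i → cong (λ m → c (suc i) * ι (⟦ t ≡ᵇ m ⟧ ℕ.* K)) (double-suc (toℕ i)))))
          (byCase t)
    where
    rest : ℕ → ℚ
    rest t = sumℚ r (λ i → c (suc i) * ι (⟦ t ≡ᵇ suc (suc (2 ℕ.* toℕ i)) ⟧ ℕ.* K))
    rest-zero : ∀ t → (∀ a → (t ≡ᵇ suc (suc a)) ≡ Bool.false) → rest t ≡ 0ℚ
    rest-zero t never = sumℚ-zero r _ (λ i →
      trans (cong (λ b → c (suc i) * ι (⟦ b ⟧ ℕ.* K)) (never (2 ℕ.* toℕ i))) (*-zeroʳ (c (suc i))))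
    ring : ∀ x y → x * y + 0ℚ ≡ x * y
    ring = solve-∀ ℚ-ring
    ring₀ : ∀ x y → x * 0ℚ + 0ℚ ≡ 0ℚ * y
    ring₀ = solve-∀ ℚ-ring
    ring₁ : ∀ x z → x * 0ℚ + z ≡ z
    ring₁ = solve-∀ ℚ-ring
    byCase : ∀ t → c zero * ι (⟦ t ≡ᵇ 0 ⟧ ℕ.* K) + rest t ≡ onEvens c t * ι K
    byCase zero = trans (cong₂ (λ m z → c zero * ι m + z) (NP.*-identityˡ K) (rest-zero 0 (λ _ → refl))) (ring (c zero) (ι K))
    byCase (suc zero) = trans (cong (c zero * 0ℚ +_) (rest-zero 1 (λ _ → refl))) (ring₀ (c zero) (ι K))
    byCase (suc (suc t)) = trans (ring₁ (c zero) (rest (suc (suc t)))) (sift (λ i → c (suc i)) t K)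

  sift₂ : ∀ {r} (c : Fin r → ℚ) t K → sumℚ r (λ i → c i * ι (⟦ t ≡ᵇ suc (suc (2 ℕ.* toℕ i)) ⟧ ℕ.* K)) ≡ shift₂ (onEvens c) t * ι K
  sift₂ {r} c zero K = trans (sumℚ-zero r _ (λ i → *-zeroʳ (c i))) (sym (*-zeroˡ (ι K)))
  sift₂ {r} c (suc zero) K = trans (sumℚ-zero r _ (λ i → *-zeroʳ (c i))) (sym (*-zeroˡ (ι K)))
  sift₂ c (suc (suc t)) K = sift c t K

  linComb-Tfamily : ∀ n h (c : Fin (suc h) → ℚ) (δ : Vec Bool n) → linComb c (Tfamily n h) δ ≡ Tsum n (onEvens c) (weight δ)
  linComb-Tfamily n h c δ =
    begin
      sumℚ (suc h) (λ i → c i * T n (2 ℕ.* toℕ i) δ)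
    ≡⟨ sumℚ-cong (suc h) _ _ termwise ⟩
      sumℚ (suc h) (λ i → (c i * ι (X₁ i) + c i * ι (X₂ i)) + c i * ι (X₃ i))
    ≡⟨ trans (sumℚ-+ (suc h) (λ i → c i * ι (X₁ i) + c i * ι (X₂ i)) (λ i → c i * ι (X₃ i)))
             (cong (_+ sumℚ (suc h) (λ i → c i * ι (X₃ i))) (sumℚ-+ (suc h) (λ i → c i * ι (X₁ i)) (λ i → c i * ι (X₂ i)))) ⟩
      sumℚ (suc h) (λ i → c i * ι (X₁ i)) + sumℚ (suc h) (λ i → c i * ι (X₂ i)) + sumℚ (suc h) (λ i → c i * ι (X₃ i))
    ≡⟨ cong₂ _+_ (cong₂ _+_ (sift₂ c s (choose2 s)) (sift c s (s ℕ.* (n ∸ s)))) (sift c (suc (suc s)) (choose2 (n ∸ s))) ⟩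
      shift₂ f s * ι (choose2 s) + f s * ι (s ℕ.* (n ∸ s)) + f (suc (suc s)) * ι (choose2 (n ∸ s))
    ≡⟨ commute (shift₂ f s) (ι (choose2 s)) (f s) (ι (s ℕ.* (n ∸ s))) (f (suc (suc s))) (ι (choose2 (n ∸ s))) ⟩
      Tsum n f s
    ∎
    where
    open ≡-Reasoning
    s = weight δ
    f = onEvens c
    X₁ X₂ X₃ : Fin (suc h) → ℕ
    X₁ i = ⟦ s ≡ᵇ suc (suc (2 ℕ.* toℕ i)) ⟧ ℕ.* choose2 s
    X₂ i = ⟦ s ≡ᵇ 2 ℕ.* toℕ i ⟧ ℕ.* (s ℕ.* (n ∸ s))
    X₃ i = ⟦ suc (suc s) ≡ᵇ 2 ℕ.* toℕ i ⟧ ℕ.* choose2 (n ∸ s)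
    distrib : ∀ g a b c → g * (a + b + c) ≡ g * a + g * b + g * c
    distrib = solve-∀ ℚ-ring
    commute : ∀ a A b B c C → a * A + b * B + c * C ≡ A * a + B * b + C * c
    commute = solve-∀ ℚ-ring
    termwise : ∀ i → c i * T n (2 ℕ.* toℕ i) δ ≡ (c i * ι (X₁ i) + c i * ι (X₂ i)) + c i * ι (X₃ i)
    termwise i = trans (cong (c i *_)
      (trans (sym (ι≡/1 (Tcoeff n (2 ℕ.* toℕ i) δ))) (trans (cong ι (Tcoeff-formula n (2 ℕ.* toℕ i) δ))
        (trans (ι-+ (X₁ i ℕ.+ X₂ i) (X₃ i)) (cong (_+ ι (X₃ i)) (ι-+ (X₁ i) (X₂ i)))))))
      (distrib (c i) (ι (X₁ i)) (ι (X₂ i)) (ι (X₃ i)))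

module Rank where

  open import Data.Nat as ℕ using (ℕ; zero; suc; _∸_; _≤_; _<_; z≤n; s≤s; ∣_-_∣; _≤?_)
  import Data.Nat.Properties as NP
  open import Data.Nat.Divisibility using (_∣_; n∣m⇒m%n≡0)
  open import Data.Nat.DivMod using (m≡m%n+[m/n]*n)
  import Data.Nat.Tactic.RingSolver as ℕ-Solver
  open import Data.Rational using (ℚ; 0ℚ; 1ℚ; _+_; _*_; _-_; -_; 1/_)
  open import Data.Rational.Properties using (_≟_; *-inverseˡ; *-zeroʳ; *-zeroˡ; *-assoc; *-distribˡ-+)
  open import Data.Rational.Base using (≢-nonZero)
  open import Relation.Binary.PropositionalEquality
  open import Relation.Nullary using (¬_; yes; no)
  open import Data.Product using (_×_; _,_; proj₁; proj₂; ∃; Σ)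
  open import Data.Sum using (_⊎_; inj₁; inj₂)
  open import Data.Empty using (⊥-elim)
  open import Tactic.RingSolver using (solve-∀)
  open import Data.Fin using (Fin; zero; suc; toℕ; fromℕ<)
  import Data.Fin.Properties as FinP
  open import Data.Vec using (Vec; []; _∷_)
  open import Data.Bool using (Bool; true; false)
  open import Defs using (sumℚ; linComb; Tfamily; weight; LinIndep; InSpan; DimSpan)
  open Kac
  open Bridge
  open Counting using (choose2; weight≤)

  unitVector : ∀ {r} → Fin r → Fin r → ℚ
  unitVector zero zero = 1ℚ
  unitVector zero (suc _) = 0ℚ
  unitVector (suc j) zero = 0ℚ
  unitVector (suc j) (suc i) = unitVector j i

  sumℚ-unitVector : ∀ r (j : Fin r) (w : Fin r → ℚ) → sumℚ r (λ i → unitVector j i * w i) ≡ w j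
  sumℚ-unitVector (suc r) zero w = trans (cong (1ℚ * w zero +_) (sumℚ-zero r _ (λ i → *-zeroˡ (w (suc i))))) (ring (w zero))
    where
    ring : ∀ x → 1ℚ * x + 0ℚ ≡ x
    ring = solve-∀ ℚ-ring
  sumℚ-unitVector (suc r) (suc j) w = trans (cong (0ℚ * w zero +_) (sumℚ-unitVector r j (λ i → w (suc i)))) (ring (w zero) (w (suc j)))
    where
    ring : ∀ x y → 0ℚ * x + y ≡ y
    ring = solve-∀ ℚ-ring

  member-inSpan : ∀ {X : Set} r (v : Fin r → X → ℚ) j → InSpan v (v j)
  member-inSpan r v j = unitVector j , (λ x → sumℚ-unitVector r j (λ i → v i x))

  sumℚ-scale : ∀ r k (f : Fin r → ℚ) → sumℚ r (λ i → k * f i) ≡ k * sumℚ r f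
  sumℚ-scale zero k f = sym (*-zeroʳ k)
  sumℚ-scale (suc r) k f = trans (cong (k * f zero +_) (sumℚ-scale r k _)) (sym (*-distribˡ-+ k (f zero) _))

  solve-for-first : ∀ {X : Set} r (v : Fin (suc r) → X → ℚ) (c : Fin (suc r) → ℚ) →
                    (∀ x → linComb c v x ≡ 0ℚ) → ¬ (c zero ≡ 0ℚ) → InSpan (λ i → v (suc i)) (v zero)
  solve-for-first {X} r v c dependency c₀≢0 = (λ i → (- k) * c (suc i)) , solved
    where
    instance _ = ≢-nonZero c₀≢0
    k = 1/ (c zero)
    open ≡-Reasoning
    ring₁ : ∀ a s → s ≡ (a + s) - a
    ring₁ = solve-∀ ℚ-ring
    ring₂ : ∀ k c t → (- k) * (0ℚ - c * t) ≡ (k * c) * t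
    ring₂ = solve-∀ ℚ-ring
    ring₃ : ∀ t → 1ℚ * t ≡ t
    ring₃ = solve-∀ ℚ-ring
    solved : ∀ x → linComb (λ i → (- k) * c (suc i)) (λ i → v (suc i)) x ≡ v zero x
    solved x = begin
        sumℚ r (λ i → ((- k) * c (suc i)) * v (suc i) x)
      ≡⟨ sumℚ-cong r _ _ (λ i → *-assoc (- k) (c (suc i)) (v (suc i) x)) ⟩
        sumℚ r (λ i → (- k) * (c (suc i) * v (suc i) x))
      ≡⟨ sumℚ-scale r (- k) _ ⟩
        (- k) * rest
      ≡⟨ cong ((- k) *_) (trans (ring₁ (c zero * v zero x) rest) (cong (_- c zero * v zero x) (dependency x))) ⟩
        (- k) * (0ℚ - c zero * v zero x)
      ≡⟨ ring₂ k (c zero) (v zero x) ⟩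
        (k * c zero) * v zero x
      ≡⟨ cong (_* v zero x) (*-inverseˡ (c zero)) ⟩
        1ℚ * v zero x
      ≡⟨ ring₃ (v zero x) ⟩
        v zero x
      ∎
      where
      rest = sumℚ r (λ i → c (suc i) * v (suc i) x)

  wordOfWeight : ∀ n → ℕ → Vec Bool n
  wordOfWeight zero s = []
  wordOfWeight (suc n) zero = false ∷ wordOfWeight n zero
  wordOfWeight (suc n) (suc s) = true ∷ wordOfWeight n s

  weight-wordOfWeight : ∀ n s → s ≤ n → weight (wordOfWeight n s) ≡ s
  weight-wordOfWeight zero zero _ = refl
  weight-wordOfWeight (suc n) zero _ = weight-wordOfWeight n zero z≤n
  weight-wordOfWeight (suc n) (suc s) (s≤s s≤n) = cong suc (weight-wordOfWeight n s s≤n)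

  Tsum-of-dependency : ∀ n h (c : Fin (suc h) → ℚ) → (∀ x → linComb c (Tfamily n h) x ≡ 0ℚ) →
                       ∀ s → s ≤ n → Tsum n (onEvens c) s ≡ 0ℚ
  Tsum-of-dependency n h c dependency s s≤n =
    trans (cong (Tsum n (onEvens c)) (sym (weight-wordOfWeight n s s≤n)))
      (trans (sym (linComb-Tfamily n h c (wordOfWeight n s))) (dependency (wordOfWeight n s)))

  D²-of-Tsum-zero : ∀ n f → (∀ s → s ≤ n → Tsum n f s ≡ 0ℚ) → D n (D n (withBinomial n f)) ≈ scale (ι n) (withBinomial n f)
  D²-of-Tsum-zero n f Tsum≡0 v with v ≤? n
  ... | yes v≤n =
    trans (D²-withBinomial n f v) (trans (cong (C n v *_) (A² n f v v≤n))
      (trans (cong (λ z → C n v * (ι n * f v + (1ℚ + 1ℚ) * z)) (Tsum≡0 v v≤n)) (ring (C n v) (ι n) (f v))))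
    where
    ring : ∀ C N x → C * (N * x + (1ℚ + 1ℚ) * 0ℚ) ≡ N * (C * x)
    ring = solve-∀ ℚ-ring
  ... | no v≰n = trans (D-supported n _ (D-supported n _ (withBinomial-supported n f)) v n<v)
                      (sym (trans (cong (ι n *_) (withBinomial-supported n f v n<v)) (*-zeroʳ (ι n))))
    where
    n<v = NP.≰⇒> v≰n

  Tsum-zero-of-D² : ∀ n f → D n (D n (withBinomial n f)) ≈ scale (ι n) (withBinomial n f) → ∀ s → s ≤ n → Tsum n f s ≡ 0ℚ
  Tsum-zero-of-D² n f D²≈n s s≤n =
    cancel-nonzero (1ℚ + 1ℚ) _ (cancel-nonzero (C n s) _ twiceTsum≡0 (C-nonzero n s s≤n)) (λ ())
    where
    both : C n s * (ι n * f s + (1ℚ + 1ℚ) * Tsum n f s) ≡ ι n * (C n s * f s)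
    both = trans (sym (trans (D²-withBinomial n f s) (cong (C n s *_) (A² n f s s≤n)))) (D²≈n s)
    ring₁ : ∀ C N x t → C * ((1ℚ + 1ℚ) * t) ≡ C * (N * x + (1ℚ + 1ℚ) * t) - N * (C * x)
    ring₁ = solve-∀ ℚ-ring
    ring₂ : ∀ a → a - a ≡ 0ℚ
    ring₂ = solve-∀ ℚ-ring
    twiceTsum≡0 : C n s * ((1ℚ + 1ℚ) * Tsum n f s) ≡ 0ℚ
    twiceTsum≡0 = trans (ring₁ (C n s) (ι n) (f s) (Tsum n f s)) (trans (cong (_- ι n * (C n s * f s)) both) (ring₂ (ι n * (C n s * f s))))

  double≤ : ∀ h (i : Fin (suc h)) → 2 ℕ.* toℕ i ≤ h ℕ.+ h
  double≤ h i = subst (_≤ h ℕ.+ h) (ring (toℕ i)) (NP.+-mono-≤ i≤h i≤h)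
    where
    i≤h : toℕ i ≤ h
    i≤h = NP.<⇒≤pred (FinP.toℕ<n i)
    ring : ∀ x → x ℕ.+ x ≡ 2 ℕ.* x
    ring = ℕ-Solver.solve-∀

  eigenvalue-square : ∀ h k → eigenvalue (h ℕ.+ h) k * eigenvalue (h ℕ.+ h) k ≡ ι (h ℕ.+ h) →
                      h ℕ.+ h ≡ 4 ℕ.* (∣ h - k ∣ ℕ.* ∣ h - k ∣)
  eigenvalue-square h k λ²≡n = ι-injective _ _ (trans (sym λ²≡n) λ²≡4d²)
    where
    ring : ∀ H K → (H + H - K - K) * (H + H - K - K) ≡ (1ℚ + (1ℚ + (1ℚ + (1ℚ + 0ℚ)))) * ((H - K) * (H - K))
    ring = solve-∀ ℚ-ring
    λ²≡4d² : eigenvalue (h ℕ.+ h) k * eigenvalue (h ℕ.+ h) k ≡ ι (4 ℕ.* (∣ h - k ∣ ℕ.* ∣ h - k ∣))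
    λ²≡4d² = trans (cong (λ z → (z - ι k - ι k) * (z - ι k - ι k)) (ι-+ h h))
             (trans (ring (ι h) (ι k)) (trans (cong (ι 4 *_) (ι-dist² h k)) (sym (ι-* 4 (∣ h - k ∣ ℕ.* ∣ h - k ∣)))))

  independent-nonsquare : ∀ h → (¬ ∃ λ u → h ℕ.+ h ≡ 4 ℕ.* (u ℕ.* u)) → LinIndep (Tfamily (h ℕ.+ h) h)
  independent-nonsquare h nonSquare c dependency i =
    trans (sym (onEvens-even c i)) (cancel-nonzero (C n (2 ℕ.* toℕ i)) _ (F≈0 (2 ℕ.* toℕ i)) (C-nonzero n _ (double≤ h i)))
    where
    n = h ℕ.+ h
    F = withBinomial n (onEvens c)
    noRoot : ∀ k → k ≤ n → ¬ (eigenvalue n k * eigenvalue n k ≡ ι n)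
    noRoot k _ λ²≡n = nonSquare (∣ h - k ∣ , eigenvalue-square h k λ²≡n)
    F≈0 : F ≈ 0ₛ
    F≈0 = D²≈n-trivial n F (withBinomial-supported n _) (D²-of-Tsum-zero n _ (Tsum-of-dependency n h c dependency)) noRoot

  choose2-nonzero : ∀ m → 2 ≤ m → ¬ (ι (choose2 m) ≡ 0ℚ)
  choose2-nonzero (suc (suc m)) _ = ι-suc-nonzero (m ℕ.+ choose2 (suc m))
  choose2-nonzero (suc zero) (s≤s ())

  -- If Tsum_n f vanishes on 0..n and f(0) = 0, then f vanishes at the even positions ≤ n:
  -- the equation at weight 2a determines f(2a+2), whose coefficient C(n−2a, 2) is nonzero.
  forward-vanishing : ∀ n f → (∀ s → s ≤ n → Tsum n f s ≡ 0ℚ) → f 0 ≡ 0ℚ →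
                      ∀ a → 2 ℕ.* a ≤ n → f (2 ℕ.* a) ≡ 0ℚ × shift₂ f (2 ℕ.* a) ≡ 0ℚ
  forward-vanishing n f Tsum≡0 f₀≡0 zero _ = f₀≡0 , refl
  forward-vanishing n f Tsum≡0 f₀≡0 (suc a) 2a+2≤n =
    trans (cong f (double-suc a)) next , trans (cong (shift₂ f) (double-suc a)) (proj₁ previous)
    where
    s = 2 ℕ.* a
    s+2≤n : suc (suc s) ≤ n
    s+2≤n = subst (_≤ n) (double-suc a) 2a+2≤n
    previous = forward-vanishing n f Tsum≡0 f₀≡0 a (NP.≤-trans (NP.n≤1+n s) (NP.≤-trans (NP.n≤1+n (suc s)) s+2≤n))
    two≤n∸s : 2 ≤ n ∸ s
    two≤n∸s = subst (_≤ n ∸ s) (NP.m+n∸n≡m 2 s) (NP.∸-monoˡ-≤ s s+2≤n)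
    ring : ∀ A x B y w → x ≡ 0ℚ → y ≡ 0ℚ → A * x + B * y + w ≡ w
    ring A x B y w refl refl = collect A B w
      where
      collect : ∀ A B w → A * 0ℚ + B * 0ℚ + w ≡ w
      collect = solve-∀ ℚ-ring
    next : f (suc (suc s)) ≡ 0ℚ
    next = cancel-nonzero (ι (choose2 (n ∸ s))) (f (suc (suc s)))
             (trans (sym (ring (ι (choose2 s)) _ (ι (s ℕ.* (n ∸ s))) _ _ (proj₂ previous) (proj₁ previous))) (Tsum≡0 s (NP.≤-trans (NP.m≤n+m s 2) s+2≤n)))
             (choose2-nonzero (n ∸ s) two≤n∸s)

  independent-tail : ∀ h → LinIndep (λ (i : Fin h) → Tfamily (h ℕ.+ h) h (suc i))
  independent-tail h c dependency i =
    trans (sym (onEvens-even c' (suc i))) (proj₁ (forward-vanishing n (onEvens c') Tsum≡0 refl (suc (toℕ i)) (double≤ h (suc i))))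
    where
    n = h ℕ.+ h
    c' : Fin (suc h) → ℚ
    c' zero = 0ℚ
    c' (suc i) = c i
    dependency' : ∀ x → linComb c' (Tfamily n h) x ≡ 0ℚ
    dependency' x = trans (cong (_+ linComb c (λ i → Tfamily n h (suc i)) x) (*-zeroˡ (Tfamily n h zero x)))
                          (trans (cong (0ℚ +_) (dependency x)) refl)
    Tsum≡0 = Tsum-of-dependency n h c' dependency'

  RootVector : ℕ → Seq → Set
  RootVector n E = SupportedIn n E × D n (D n E) ≈ scale (ι n) E × ¬ (E 0 ≡ 0ℚ)

  -- for n = 4(u+1)², take (1+x)ᵐ(x−1)ᵇ with m + b = n and m − b = 2(u+1)
  rootVector-of-square : ∀ u → Σ Seq (RootVector (4 ℕ.* (suc u ℕ.* suc u)))
  rootVector-of-square u = subst (λ N → Σ Seq (RootVector N)) m+b≡n (E , kacEigenvector-supported m b , D²E , E₀≢0)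
    where
    b = suc u ℕ.* suc (2 ℕ.* u)
    m = 2 ℕ.* suc u ℕ.+ b
    E = kacEigenvector m b
    m+b≡n : m ℕ.+ b ≡ 4 ℕ.* (suc u ℕ.* suc u)
    m+b≡n = ring u
      where
      ring : ∀ u → (2 ℕ.* suc u ℕ.+ suc u ℕ.* suc (2 ℕ.* u)) ℕ.+ suc u ℕ.* suc (2 ℕ.* u) ≡ 4 ℕ.* (suc u ℕ.* suc u)
      ring = ℕ-Solver.solve-∀
    m-b≡2u+2 : ι m - ι b ≡ ι (2 ℕ.* suc u)
    m-b≡2u+2 = trans (cong (_- ι b) (ι-+ (2 ℕ.* suc u) b)) (ring (ι (2 ℕ.* suc u)) (ι b))
      where
      ring : ∀ a c → (a + c) - c ≡ a
      ring = solve-∀ ℚ-ring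
    square≡m+b : (2 ℕ.* suc u) ℕ.* (2 ℕ.* suc u) ≡ m ℕ.+ b
    square≡m+b = ring u
      where
      ring : ∀ u → (2 ℕ.* suc u) ℕ.* (2 ℕ.* suc u) ≡ (2 ℕ.* suc u ℕ.+ suc u ℕ.* suc (2 ℕ.* u)) ℕ.+ suc u ℕ.* suc (2 ℕ.* u)
      ring = ℕ-Solver.solve-∀
    D²E : D (m ℕ.+ b) (D (m ℕ.+ b) E) ≈ scale (ι (m ℕ.+ b)) E
    D²E v = trans (kacEigenvector-D² m b v) (cong (_* E v)
      (trans (cong₂ _*_ m-b≡2u+2 m-b≡2u+2) (trans (sym (ι-* (2 ℕ.* suc u) (2 ℕ.* suc u))) (cong ι square≡m+b))))
    E₀≢0 : ¬ (E 0 ≡ 0ℚ)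
    E₀≢0 E₀≡0 = 0≢1 (trans (sym (*-zeroˡ (E 0))) (trans (cong (_* E 0) (sym E₀≡0)) (kacEigenvector-0 m b)))

  -- a total inverse (with 0⁻¹ = 0), used to divide by binomial coefficients
  inv₀ : ℚ → ℚ
  inv₀ x with x ≟ 0ℚ
  ... | yes _ = 0ℚ
  ... | no x≢0 = (1/ x) {{≢-nonZero x≢0}}

  inv₀-cancel : ∀ x y → (x ≡ 0ℚ → y ≡ 0ℚ) → x * (y * inv₀ x) ≡ y
  inv₀-cancel x y y≡0-if with x ≟ 0ℚ
  ... | yes x≡0 = trans (cong (_* (y * 0ℚ)) x≡0) (trans (*-zeroˡ (y * 0ℚ)) (sym (y≡0-if x≡0)))
  ... | no x≢0 = trans (ring x y ((1/ x) {{≢-nonZero x≢0}})) (trans (cong (y *_) (*-inverseˡ x {{≢-nonZero x≢0}})) (ring₁ y))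
    where
    ring : ∀ x y z → x * (y * z) ≡ y * (z * x)
    ring = solve-∀ ℚ-ring
    ring₁ : ∀ y → y * 1ℚ ≡ y
    ring₁ = solve-∀ ℚ-ring

  parity : ∀ s → ∃ λ a → (s ≡ 2 ℕ.* a) ⊎ (s ≡ suc (2 ℕ.* a))
  parity zero = 0 , inj₁ refl
  parity (suc s) with parity s
  ... | a , inj₁ s≡2a = a , inj₂ (cong suc s≡2a)
  ... | a , inj₂ s≡2a+1 = suc a , inj₁ (trans (cong suc s≡2a+1) (sym (double-suc a)))

  -- Tsum couples only positions of equal parity: passing to the even part of f preserves its zeros
  Tsum-even-part : ∀ n f g → (∀ a → g (2 ℕ.* a) ≡ f (2 ℕ.* a)) → (∀ a → g (suc (2 ℕ.* a)) ≡ 0ℚ) →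
                   ∀ s → Tsum n f s ≡ 0ℚ → Tsum n g s ≡ 0ℚ
  Tsum-even-part n f g even odd s Tsum≡0 with parity s
  ... | a , inj₁ refl = trans (Tsum-cong (shift₂-even a) (even a) (trans (cong g (sym (double-suc a))) (trans (even (suc a)) (cong f (double-suc a))))) Tsum≡0
    where
    Tsum-cong : ∀ {x x' y y' z z'} → x ≡ x' → y ≡ y' → z ≡ z' →
                ι (choose2 s) * x + ι (s ℕ.* (n ∸ s)) * y + ι (choose2 (n ∸ s)) * z ≡ ι (choose2 s) * x' + ι (s ℕ.* (n ∸ s)) * y' + ι (choose2 (n ∸ s)) * z'
    Tsum-cong refl refl refl = refl
    shift₂-even : ∀ a → shift₂ g (2 ℕ.* a) ≡ shift₂ f (2 ℕ.* a)
    shift₂-even zero = refl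
    shift₂-even (suc a) = trans (cong (shift₂ g) (double-suc a)) (trans (even a) (cong (shift₂ f) (sym (double-suc a))))
  ... | a , inj₂ refl =
    trans (cong₂ _+_ (cong₂ _+_ (cong (ι (choose2 s) *_) (shift₂-odd a)) (cong (ι (s ℕ.* (n ∸ s)) *_) (odd a)))
                     (cong (ι (choose2 (n ∸ s)) *_) (trans (cong (λ z → g (suc z)) (sym (double-suc a))) (odd (suc a)))))
          (ring (ι (choose2 s)) (ι (s ℕ.* (n ∸ s))) (ι (choose2 (n ∸ s))))
    where
    shift₂-odd : ∀ a → shift₂ g (suc (2 ℕ.* a)) ≡ 0ℚ
    shift₂-odd zero = refl
    shift₂-odd (suc a) = trans (cong (λ z → shift₂ g (suc z)) (double-suc a)) (odd a)
    ring : ∀ A B C → A * 0ℚ + B * 0ℚ + C * 0ℚ ≡ 0ℚ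
    ring = solve-∀ ℚ-ring

  -- given such a vector for n = 2h, T_0 is a combination of T_2, ..., T_n:
  -- E = C·f, Tsum_n f = 0, the even part of f is a dependency, and its first coefficient is f(0) ≠ 0
  T₀-inSpan : ∀ h → Σ Seq (RootVector (h ℕ.+ h)) → InSpan (λ (i : Fin h) → Tfamily (h ℕ.+ h) h (suc i)) (Tfamily (h ℕ.+ h) h zero)
  T₀-inSpan h (E , supp , D²E , E₀≢0) = solve-for-first h (Tfamily n h) c dependency c₀≢0
    where
    n = h ℕ.+ h
    f : Seq
    f v = E v * inv₀ (C n v)
    E-vanishes : ∀ v → C n v ≡ 0ℚ → E v ≡ 0ℚ
    E-vanishes v C≡0 with v ≤? n
    ... | yes v≤n = ⊥-elim (C-nonzero n v v≤n C≡0)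
    ... | no v≰n = supp v (NP.≰⇒> v≰n)
    Cf≈E : withBinomial n f ≈ E
    Cf≈E v = inv₀-cancel (C n v) (E v) (E-vanishes v)
    Tsum-f : ∀ s → s ≤ n → Tsum n f s ≡ 0ℚ
    Tsum-f = Tsum-zero-of-D² n f (λ v →
      trans (proj₁ (D-linear n) _ _ (proj₁ (D-linear n) _ _ Cf≈E) v) (trans (D²E v) (cong (ι n *_) (sym (Cf≈E v)))))
    c : Fin (suc h) → ℚ
    c i = f (2 ℕ.* toℕ i)
    evens-agree : ∀ a → onEvens c (2 ℕ.* a) ≡ f (2 ℕ.* a)
    evens-agree a with a ℕ.<? suc h
    ... | yes a≤h = trans (cong (λ z → onEvens c (2 ℕ.* z)) (sym (FinP.toℕ-fromℕ< a≤h)))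
                          (trans (onEvens-even c (fromℕ< a≤h)) (cong (λ z → f (2 ℕ.* z)) (FinP.toℕ-fromℕ< a≤h)))
    ... | no a≰h = trans (onEvens-beyond c a h<a) (sym (trans (cong (_* inv₀ (C n (2 ℕ.* a))) (supp (2 ℕ.* a) n<2a)) (*-zeroˡ (inv₀ (C n (2 ℕ.* a))))))
      where
      h<a : suc h ≤ a
      h<a = NP.≮⇒≥ a≰h
      ring : ∀ a → a ℕ.+ a ≡ 2 ℕ.* a
      ring = ℕ-Solver.solve-∀
      n<2a : n < 2 ℕ.* a
      n<2a = subst (n <_) (ring a) (NP.+-mono-< h<a h<a)
    dependency : ∀ x → linComb c (Tfamily n h) x ≡ 0ℚ
    dependency x = trans (linComb-Tfamily n h c x)
      (Tsum-even-part n f (onEvens c) evens-agree (onEvens-odd c) (weight x) (Tsum-f (weight x) (weight≤ x)))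
    c₀≢0 : ¬ (c zero ≡ 0ℚ)
    c₀≢0 c₀≡0 = E₀≢0 (trans (sym (Cf≈E 0)) (trans (cong (C n 0 *_) c₀≡0) (*-zeroʳ (C n 0))))

  Dimension : ℕ → ℕ → Set
  Dimension n h = ((¬ ∃ λ u → n ≡ 4 ℕ.* (u ℕ.* u)) → DimSpan (Tfamily n h) (suc h))
                × ((∃ λ u → n ≡ 4 ℕ.* (u ℕ.* u)) → DimSpan (Tfamily n h) h)

  -- the theorem for n = h + h > 0; positivity excludes the degenerate square n = 4·0²
  dimension-even : ∀ h → 0 < h ℕ.+ h → Dimension (h ℕ.+ h) h
  dimension-even h 0<n = nonsquare , square
    where
    n = h ℕ.+ h
    nonsquare : (¬ ∃ λ u → n ≡ 4 ℕ.* (u ℕ.* u)) → DimSpan (Tfamily n h) (suc h)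
    nonsquare nonSquare = (λ i → i) , independent-nonsquare h nonSquare , member-inSpan (suc h) (Tfamily n h)
    square : (∃ λ u → n ≡ 4 ℕ.* (u ℕ.* u)) → DimSpan (Tfamily n h) h
    square (zero , n≡0) = ⊥-elim (NP.<⇒≢ 0<n (sym n≡0))
    square (suc u , n≡4u²) = suc , independent-tail h , spans
      where
      spans : ∀ j → InSpan (λ i → Tfamily n h (suc i)) (Tfamily n h j)
      spans zero = T₀-inSpan h (subst (λ N → Σ Seq (RootVector N)) (sym n≡4u²) (rootVector-of-square u))
      spans (suc j) = member-inSpan h (λ i → Tfamily n h (suc i)) j

  half+half : ∀ n → 2 ∣ n → n ≡ n ℕ./ 2 ℕ.+ n ℕ./ 2
  half+half n 2∣n = trans (m≡m%n+[m/n]*n n 2)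
    (trans (cong (ℕ._+ n ℕ./ 2 ℕ.* 2) (n∣m⇒m%n≡0 n 2 2∣n)) (ring (n ℕ./ 2)))
    where
    ring : ∀ h → 0 ℕ.+ h ℕ.* 2 ≡ h ℕ.+ h
    ring = ℕ-Solver.solve-∀

open import Defs
open import Data.Nat using (ℕ; suc; _+_; _*_; _<_; _/_)
open import Data.Nat.Divisibility using (_∣_; ∣-trans; divides)
open import Data.Product using (_×_; ∃)
open import Relation.Binary.PropositionalEquality using (_≡_; refl; subst; sym)
open import Relation.Nullary using (¬_)
open Rank using (Dimension; dimension-even; half+half)

lemma4 : (n : ℕ) → 0 < n → 4 ∣ n →
    ((¬ ∃ λ u → n ≡ 4 * (u * u)) → DimSpan (Tfamily n (n / 2)) (suc (n / 2)))
    × ((∃ λ u → n ≡ 4 * (u * u)) → DimSpan (Tfamily n (n / 2)) (n / 2))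
lemma4 n 0<n 4∣n = subst (λ m → Dimension m (n / 2)) (sym n≡h+h) (dimension-even (n / 2) (subst (0 <_) n≡h+h 0<n))
  where
  n≡h+h : n ≡ n / 2 + n / 2
  n≡h+h = half+half n (∣-trans (divides 2 refl) 4∣n)
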